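{- Let $c$ be a $d$-dimensional finitary integral configuration with a non-trivial annihilator. Then there are non-zero vectors $\vec v_1,\dots,\vec v_m\in\mathbb{Z}^d$ such that the Laurent polynomial $(X^{\vec v_1}-1)\cdots(X^{\vec v_m}-1)$ annihilates $c$.
   Context: A $d$-dimensional configuration is a formal power series $c=\sum_{\vec v\in\mathbb{Z}^d}c_{\vec v}X^{\vec v}$ with complex coefficients, $X^{\vec v}=x_1^{v_1}\cdots x_d^{v_d}$. It is integral if all $c_{\vec v}\in\mathbb{Z}$, finitary if only finitely many distinct values $c_{\vec v}$ occur. For a Laurent polynomial $f=\sum_{\vec u}a_{\vec u}X^{\vec u}$, $fc$ is the configuration with $(fc)_{\vec v}=\sum_{\vec u}a_{\vec u}c_{\vec v-\vec u}$; $f$ annihilates $c$ if $fc=0$, and a non-trivial annihilator is a non-zero Laurent polynomial annihilating $c$. -}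

module Defs where

open import Level using (Level)
open import Data.Nat using (ℕ; zero; suc)
open import Data.Integer using (ℤ; +_; -[1+_]) renaming (_+_ to _+ℤ_; _-_ to _-ℤ_; 0ℤ to 0ℤ)
open import Data.Vec using (Vec; zipWith; replicate)
open import Data.List using (List; []; _∷_; foldr)
import Data.List
open import Data.List.Membership.Propositional using (_∈_)
open import Data.List.Relation.Unary.Unique.Propositional using (Unique)
open import Data.Product using (Σ; ∃; _×_; _,_)
open import Relation.Nullary using (¬_)
open import Relation.Binary.PropositionalEquality using (_≡_; _≢_)
open import Algebra.Bundles using (CommutativeRing)

Point : ℕ → Set
Point d = Vec ℤ d

_⊖_ : ∀ {d} → Point d → Point d → Point d
u ⊖ v = zipWith _-ℤ_ u v

origin : ∀ d → Point d
origin d = replicate d 0ℤ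

Config : ℕ → Set
Config d = Point d → ℤ

Finitary : ∀ {d} → Config d → Set
Finitary c = Σ (List ℤ) λ vals → ∀ v → c v ∈ vals

module OverRing {a ℓ} (K : CommutativeRing a ℓ) where
  open CommutativeRing K

  IsField : Set (a Level.⊔ ℓ)
  IsField = (¬ (1# ≈ 0#)) × (∀ x → ¬ (x ≈ 0#) → Σ Carrier λ y → (x * y) ≈ 1#)

  natK : ℕ → Carrier
  natK zero = 0#
  natK (suc n) = 1# + natK n

  CharZero : Set ℓ
  CharZero = ∀ n → ¬ (natK (suc n) ≈ 0#)

  intK : ℤ → Carrier
  intK (+ n) = natK n
  intK -[1+ n ] = - natK (suc n)

  sumK : List Carrier → Carrier
  sumK = foldr _+_ 0#

  -- A Laurent polynomial over K in d variables: a coefficient function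
  -- Z^d → K together with a finite duplicate-free list containing its support.
  record Laurent (d : ℕ) : Set (a Level.⊔ ℓ) where
    field
      coeff   : Point d → Carrier
      support : List (Point d)
      unique  : Unique support
      finite  : ∀ u → ¬ (coeff u ≈ 0#) → u ∈ support

  open Laurent public

  NonZero : ∀ {d} → Laurent d → Set ℓ
  NonZero f = ∃ λ u → ¬ (coeff f u ≈ 0#)

  act : ∀ {d} → Laurent d → Config d → Point d → Carrier
  act f c v = sumK (Data.List.map (λ u → coeff f u * intK (c (v ⊖ u))) (support f))

  Annihilates : ∀ {d} → Laurent d → Config d → Set ℓ
  Annihilates f c = ∀ v → act f c v ≈ 0#

  HasNontrivialAnnihilator : ∀ {d} → Config d → Set (a Level.⊔ ℓ)
  HasNontrivialAnnihilator c = Σ (Laurent _) λ f → NonZero f × Annihilates f c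

-- (X^v - 1) c : its value at x is c_{x-v} - c_x
diffOp : ∀ {d} → Point d → Config d → Config d
diffOp v c x = c (x ⊖ v) -ℤ c x

-- (X^{v_1}-1)⋯(X^{v_m}-1) c, applied factor by factor
diffProd : ∀ {d} → List (Point d) → Config d → Config d
diffProd [] c = c
diffProd (v ∷ vs) c = diffOp v (diffProd vs c)

{-# OPTIONS --safe #-}
-- Since c is finitary, the patterns (c (x ⊖ u)) for u in the support of the annihilator f range
-- over a finite set, and the coefficient vector of f is a non-zero solution over K of the integer
-- linear system these patterns define. Gaussian elimination (K has characteristic 0) then yields a
-- non-zero integer solution, i.e. an integer annihilator L = Σ a X^w of c.
--
-- For a prime p, Frobenius and Fermat give L^p = L^(p) + p r, where L^(p) = dilate p L replaces
-- each X^w by X^(p w). Since L^p annihilates c, the values of L^(p) c are multiples of p of absolute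
-- value at most B = ‖L‖₁ C, where C bounds ∣c∣, hence zero once p > B. Dilations compose and keep
-- ‖L‖₁, so L^(n) annihilates c for every n without prime factors ≤ B, in particular for every
-- n = 1 + k M with M = B!.
-- Lagrange interpolation in the monomials X^(M (w - u)) turns these annihilators into
-- b X^u Π (X^(M (w - u)) - 1), where b X^u is a term of L with b ≠ 0 and w runs over the other
-- exponents of L.
--
-- Which patterns are orthogonal to the coefficients of f cannot be decided in K, so the vectors
-- produced are those of all candidate sets of patterns together. One candidate is the right one up
-- to double negation, which suffices because the conclusion is a decidable equation in ℤ.
module Submission where

open import Defs
open import Algebra.Bundles using (CommutativeRing)

module Points where
  open import Data.Integer as ℤ using (ℤ; +_; 0ℤ; 1ℤ; _+_; _*_; -_; _-_)
  import Data.Integer.Properties as ℤP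
  open import Data.Integer.Tactic.RingSolver using (solve-∀)
  open import Data.Vec using ([]; _∷_; zipWith; map)
  open import Data.Vec.Properties using (∷-injectiveˡ; ∷-injectiveʳ)
  open import Data.Sum using (_⊎_; inj₁; inj₂)
  open import Relation.Binary.PropositionalEquality

  infixl 6 _⊕_
  infixr 7 _·_

  _⊕_ : ∀ {d} → Point d → Point d → Point d
  _⊕_ = zipWith _+_

  _·_ : ∀ {d} → ℤ → Point d → Point d
  k · u = map (k *_) u

  ⊖-⊖ : ∀ {d} (x u w : Point d) → (x ⊖ u) ⊖ w ≡ x ⊖ (u ⊕ w)
  ⊖-⊖ []       []       []       = refl
  ⊖-⊖ (x ∷ xs) (u ∷ us) (w ∷ ws) = cong₂ _∷_ (scalar x u w) (⊖-⊖ xs us ws)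
    where
    scalar : ∀ x u w → x - u - w ≡ x - (u + w)
    scalar = solve-∀

  ⊖-comm : ∀ {d} (x u w : Point d) → (x ⊖ u) ⊖ w ≡ (x ⊖ w) ⊖ u
  ⊖-comm []       []       []       = refl
  ⊖-comm (x ∷ xs) (u ∷ us) (w ∷ ws) = cong₂ _∷_ (scalar x u w) (⊖-comm xs us ws)
    where
    scalar : ∀ x u w → x - u - w ≡ x - w - u
    scalar = solve-∀

  ⊖-identityʳ : ∀ {d} (x : Point d) → x ⊖ origin d ≡ x
  ⊖-identityʳ []       = refl
  ⊖-identityʳ (x ∷ xs) = cong₂ _∷_ (ℤP.+-identityʳ x) (⊖-identityʳ xs)

  ⊕-⊖-cancel : ∀ {d} (x u : Point d) → (x ⊕ u) ⊖ u ≡ x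
  ⊕-⊖-cancel []       []       = refl
  ⊕-⊖-cancel (x ∷ xs) (u ∷ us) = cong₂ _∷_ (scalar x u) (⊕-⊖-cancel xs us)
    where
    scalar : ∀ x u → x + u - u ≡ x
    scalar = solve-∀

  ·-zeroˡ : ∀ {d} (u : Point d) → 0ℤ · u ≡ origin d
  ·-zeroˡ []       = refl
  ·-zeroˡ (u ∷ us) = cong (0ℤ ∷_) (·-zeroˡ us)

  ·-identityˡ : ∀ {d} (u : Point d) → 1ℤ · u ≡ u
  ·-identityˡ []       = refl
  ·-identityˡ (u ∷ us) = cong₂ _∷_ (ℤP.*-identityˡ u) (·-identityˡ us)

  ·-assoc : ∀ {d} k l (u : Point d) → k · l · u ≡ (k * l) · u
  ·-assoc k l []       = refl
  ·-assoc k l (u ∷ us) = cong₂ _∷_ (sym (ℤP.*-assoc k l u)) (·-assoc k l us)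

  ⊕-·-suc : ∀ {d} k (u : Point d) → u ⊕ k · u ≡ (1ℤ + k) · u
  ⊕-·-suc k []       = refl
  ⊕-·-suc k (u ∷ us) = cong₂ _∷_ (scalar k u) (⊕-·-suc k us)
    where
    scalar : ∀ k u → u + k * u ≡ (1ℤ + k) * u
    scalar = solve-∀

  ·-⊖-self : ∀ {d} k (u : Point d) → k · (u ⊖ u) ≡ origin d
  ·-⊖-self k []       = refl
  ·-⊖-self k (u ∷ us) = cong₂ _∷_ (scalar k u) (·-⊖-self k us)
    where
    scalar : ∀ k u → k * (u - u) ≡ 0ℤ
    scalar = solve-∀

  ·-⊖≡origin : ∀ {d} k (w u : Point d) → k · (w ⊖ u) ≡ origin d → k ≡ 0ℤ ⊎ w ≡ u
  ·-⊖≡origin k []       []       _ = inj₂ refl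
  ·-⊖≡origin k (w ∷ ws) (u ∷ us) eq with ℤP.i*j≡0⇒i≡0∨j≡0 k (∷-injectiveˡ eq) | ·-⊖≡origin k ws us (∷-injectiveʳ eq)
  ... | inj₁ k≡0  | _          = inj₁ k≡0
  ... | inj₂ _    | inj₁ k≡0   = inj₁ k≡0
  ... | inj₂ w-u≡0 | inj₂ ws≡us = inj₂ (cong₂ _∷_ (ℤP.i-j≡0⇒i≡j w u w-u≡0) ws≡us)

  ⊖-⊕-·-⊖-suc : ∀ {d} k m (x w u : Point d) →
    x ⊖ (w ⊕ ((1ℤ + k) * m) · (w ⊖ u)) ≡ (x ⊖ (m · (w ⊖ u))) ⊖ (w ⊕ (k * m) · (w ⊖ u))
  ⊖-⊕-·-⊖-suc k m []       []       []       = refl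
  ⊖-⊕-·-⊖-suc k m (x ∷ xs) (w ∷ ws) (u ∷ us) = cong₂ _∷_ (scalar k m x w u) (⊖-⊕-·-⊖-suc k m xs ws us)
    where
    scalar : ∀ k m x w u → x - (w + (1ℤ + k) * m * (w - u)) ≡ x - m * (w - u) - (w + k * m * (w - u))
    scalar = solve-∀

  ⊖-⊕-·-⊖ : ∀ {d} k (x w u : Point d) → x ⊖ (w ⊕ k · (w ⊖ u)) ≡ (x ⊕ k · u) ⊖ ((1ℤ + k) · w)
  ⊖-⊕-·-⊖ k []       []       []       = refl
  ⊖-⊕-·-⊖ k (x ∷ xs) (w ∷ ws) (u ∷ us) = cong₂ _∷_ (scalar k x w u) (⊖-⊕-·-⊖ k xs ws us)
    where
    scalar : ∀ k x w u → x - (w + k * (w - u)) ≡ x + k * u - (1ℤ + k) * w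
    scalar = solve-∀

  ⊕-·-⊖-self : ∀ {d} k (u : Point d) → u ⊕ k · (u ⊖ u) ≡ u
  ⊕-·-⊖-self k []       = refl
  ⊕-·-⊖-self k (u ∷ us) = cong₂ _∷_ (scalar k u) (⊕-·-⊖-self k us)
    where
    scalar : ∀ k u → u + k * (u - u) ≡ u
    scalar = solve-∀

module Operators where
  open Points
  open import Level using (0ℓ)
  open import Data.Nat as ℕ using (ℕ)
  open import Data.Integer as ℤ using (ℤ; 0ℤ; 1ℤ; _+_; _*_; -_; _-_)
  import Data.Integer.Properties as ℤP
  open import Data.Integer.Tactic.RingSolver using (solve-∀)
  open import Data.List using (List; []; _∷_; _++_)
  open import Data.List.Properties using (++-assoc; ++-identityʳ)
  open import Data.List.Relation.Binary.Permutation.Propositional as ↭ using (_↭_; prep; swap)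
  open import Data.Product using (_×_; _,_)
  open import Algebra.Structures using (IsAbelianGroup; IsCommutativeRing)
  open import Relation.Binary.Structures using (IsEquivalence)
  open import Relation.Binary.PropositionalEquality
  open import Function using (_⟨_⟩_)
  open import Algebra.Properties.CommutativeSemigroup ℤP.+-commutativeSemigroup using (x∙yz≈y∙xz)

  private variable d : ℕ

  -- An integer Laurent polynomial Σ a X^u, as the list of its terms (a , u).
  Op : ℕ → Set
  Op d = List (ℤ × Point d)

  ⟦_⟧ : Op d → Config d → Config d
  ⟦ []          ⟧ c x = 0ℤ
  ⟦ (a , u) ∷ L ⟧ c x = a * c (x ⊖ u) + ⟦ L ⟧ c x

  Annihilatesℤ : Op d → Config d → Set
  Annihilatesℤ L c = ∀ x → ⟦ L ⟧ c x ≡ 0ℤ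

  infixl 7 _*ᴼ_
  infix  8 -ᴼ_
  infixl 6 _-ᴼ_

  _*ᵗ_ : ℤ × Point d → Op d → Op d
  t       *ᵗ []            = []
  (a , u) *ᵗ ((b , w) ∷ M) = (a * b , u ⊕ w) ∷ (a , u) *ᵗ M

  _*ᴼ_ : Op d → Op d → Op d
  []      *ᴼ M = []
  (t ∷ L) *ᴼ M = t *ᵗ M ++ L *ᴼ M

  -ᴼ_ : Op d → Op d
  -ᴼ []            = []
  -ᴼ ((a , u) ∷ L) = (- a , u) ∷ -ᴼ L

  _-ᴼ_ : Op d → Op d → Op d
  L -ᴼ M = L ++ -ᴼ M

  1ᴼ : Op d
  1ᴼ {d} = (1ℤ , origin d) ∷ []

  ⟦⟧-cong : ∀ L {c c′ : Config d} → (∀ y → c y ≡ c′ y) → ∀ x → ⟦ L ⟧ c x ≡ ⟦ L ⟧ c′ x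
  ⟦⟧-cong []            c≗c′ x = refl
  ⟦⟧-cong ((a , u) ∷ L) c≗c′ x = cong₂ _+_ (cong (a *_) (c≗c′ (x ⊖ u))) (⟦⟧-cong L c≗c′ x)

  ⟦⟧-zero : ∀ (L : Op d) x → ⟦ L ⟧ (λ _ → 0ℤ) x ≡ 0ℤ
  ⟦⟧-zero []            x = refl
  ⟦⟧-zero ((a , u) ∷ L) x = cong₂ _+_ (ℤP.*-zeroʳ a) (⟦⟧-zero L x)

  ⟦⟧-+ : ∀ L (c c′ : Config d) x → ⟦ L ⟧ (λ y → c y + c′ y) x ≡ ⟦ L ⟧ c x + ⟦ L ⟧ c′ x
  ⟦⟧-+ []            c c′ x = refl
  ⟦⟧-+ ((a , u) ∷ L) c c′ x =
    cong (a * (c (x ⊖ u) + c′ (x ⊖ u)) +_) (⟦⟧-+ L c c′ x) ⟨ trans ⟩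
    scalar a (c (x ⊖ u)) (c′ (x ⊖ u)) (⟦ L ⟧ c x) (⟦ L ⟧ c′ x)
    where
    scalar : ∀ a p q r s → a * (p + q) + (r + s) ≡ (a * p + r) + (a * q + s)
    scalar = solve-∀

  ⟦⟧-scale : ∀ L k (c : Config d) x → ⟦ L ⟧ (λ y → k * c y) x ≡ k * ⟦ L ⟧ c x
  ⟦⟧-scale []            k c x = sym (ℤP.*-zeroʳ k)
  ⟦⟧-scale ((a , u) ∷ L) k c x =
    cong (a * (k * c (x ⊖ u)) +_) (⟦⟧-scale L k c x) ⟨ trans ⟩ scalar a k (c (x ⊖ u)) (⟦ L ⟧ c x)
    where
    scalar : ∀ a k p r → a * (k * p) + k * r ≡ k * (a * p + r)
    scalar = solve-∀

  ⟦⟧-shift : ∀ L (c : Config d) u x → ⟦ L ⟧ (λ y → c (y ⊖ u)) x ≡ ⟦ L ⟧ c (x ⊖ u)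
  ⟦⟧-shift []            c u x = refl
  ⟦⟧-shift ((a , w) ∷ L) c u x = cong₂ _+_ (cong (λ y → a * c y) (⊖-comm x w u)) (⟦⟧-shift L c u x)

  ⟦⟧-++ : ∀ (L M : Op d) c x → ⟦ L ++ M ⟧ c x ≡ ⟦ L ⟧ c x + ⟦ M ⟧ c x
  ⟦⟧-++ []            M c x = sym (ℤP.+-identityˡ _)
  ⟦⟧-++ ((a , u) ∷ L) M c x =
    cong (a * c (x ⊖ u) +_) (⟦⟧-++ L M c x) ⟨ trans ⟩ sym (ℤP.+-assoc (a * c (x ⊖ u)) _ _)

  ⟦⟧-*ᵗ : ∀ a u (M : Op d) c x → ⟦ (a , u) *ᵗ M ⟧ c x ≡ a * ⟦ M ⟧ c (x ⊖ u)
  ⟦⟧-*ᵗ a u []            c x = sym (ℤP.*-zeroʳ a)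
  ⟦⟧-*ᵗ a u ((b , w) ∷ M) c x =
    cong₂ _+_ (cong (λ y → a * b * c y) (sym (⊖-⊖ x u w))) (⟦⟧-*ᵗ a u M c x) ⟨ trans ⟩
    sym (ℤP.*-distribˡ-+ a (b * c ((x ⊖ u) ⊖ w)) _ ⟨ trans ⟩ cong (_+ a * ⟦ M ⟧ c (x ⊖ u)) (sym (ℤP.*-assoc a b _)))

  ⟦⟧-* : ∀ (L M : Op d) c x → ⟦ L *ᴼ M ⟧ c x ≡ ⟦ L ⟧ (⟦ M ⟧ c) x
  ⟦⟧-* []            M c x = refl
  ⟦⟧-* ((a , u) ∷ L) M c x =
    ⟦⟧-++ ((a , u) *ᵗ M) (L *ᴼ M) c x ⟨ trans ⟩ cong₂ _+_ (⟦⟧-*ᵗ a u M c x) (⟦⟧-* L M c x)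

  ⟦⟧-comm : ∀ (L M : Op d) c x → ⟦ L ⟧ (⟦ M ⟧ c) x ≡ ⟦ M ⟧ (⟦ L ⟧ c) x
  ⟦⟧-comm []            M c x = sym (⟦⟧-zero M x)
  ⟦⟧-comm ((a , u) ∷ L) M c x = begin
    a * ⟦ M ⟧ c (x ⊖ u) + ⟦ L ⟧ (⟦ M ⟧ c) x           ≡⟨ cong₂ _+_ (cong (a *_) (sym (⟦⟧-shift M c u x))) (⟦⟧-comm L M c x) ⟩
    a * ⟦ M ⟧ (λ y → c (y ⊖ u)) x + ⟦ M ⟧ (⟦ L ⟧ c) x ≡⟨ cong (_+ ⟦ M ⟧ (⟦ L ⟧ c) x) (sym (⟦⟧-scale M a (λ y → c (y ⊖ u)) x)) ⟩
    ⟦ M ⟧ (λ y → a * c (y ⊖ u)) x + ⟦ M ⟧ (⟦ L ⟧ c) x ≡⟨ sym (⟦⟧-+ M (λ y → a * c (y ⊖ u)) (⟦ L ⟧ c) x) ⟩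
    ⟦ M ⟧ (⟦ (a , u) ∷ L ⟧ c) x                       ∎
    where open ≡-Reasoning

  annihilates-*ˡ : ∀ (L M : Op d) {c} → Annihilatesℤ L c → Annihilatesℤ (L *ᴼ M) c
  annihilates-*ˡ L M {c} Lc≡0 x =
    ⟦⟧-* L M c x ⟨ trans ⟩ ⟦⟧-comm L M c x ⟨ trans ⟩ ⟦⟧-cong M Lc≡0 x ⟨ trans ⟩ ⟦⟧-zero M x

  ⟦⟧-neg : ∀ (L : Op d) c x → ⟦ -ᴼ L ⟧ c x ≡ - ⟦ L ⟧ c x
  ⟦⟧-neg []            c x = refl
  ⟦⟧-neg ((a , u) ∷ L) c x =
    cong₂ _+_ (sym (ℤP.neg-distribˡ-* a (c (x ⊖ u)))) (⟦⟧-neg L c x) ⟨ trans ⟩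
    sym (ℤP.neg-distrib-+ (a * c (x ⊖ u)) _)

  ⟦⟧-- : ∀ L (c c′ : Config d) x → ⟦ L ⟧ (λ y → c y - c′ y) x ≡ ⟦ L ⟧ c x - ⟦ L ⟧ c′ x
  ⟦⟧-- []            c c′ x = refl
  ⟦⟧-- ((a , u) ∷ L) c c′ x =
    cong (a * (c (x ⊖ u) - c′ (x ⊖ u)) +_) (⟦⟧-- L c c′ x) ⟨ trans ⟩
    scalar a (c (x ⊖ u)) (c′ (x ⊖ u)) (⟦ L ⟧ c x) (⟦ L ⟧ c′ x)
    where
    scalar : ∀ a p q r s → a * (p - q) + (r - s) ≡ (a * p + r) - (a * q + s)
    scalar = solve-∀

  ⟦⟧--ᴼ : ∀ (L M : Op d) c x → ⟦ L -ᴼ M ⟧ c x ≡ ⟦ L ⟧ c x - ⟦ M ⟧ c x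
  ⟦⟧--ᴼ L M c x = ⟦⟧-++ L (-ᴼ M) c x ⟨ trans ⟩ cong (⟦ L ⟧ c x +_) (⟦⟧-neg M c x)

  ⟦⟧-one : ∀ (c : Config d) x → ⟦ 1ᴼ ⟧ c x ≡ c x
  ⟦⟧-one c x = ℤP.+-identityʳ _ ⟨ trans ⟩ ℤP.*-identityˡ _ ⟨ trans ⟩ cong c (⊖-identityʳ x)

  infix 4 _≈ᴼ_

  _≈ᴼ_ : Op d → Op d → Set
  L ≈ᴼ M = ∀ c x → ⟦ L ⟧ c x ≡ ⟦ M ⟧ c x

  ≈ᴼ-isEquivalence : IsEquivalence (_≈ᴼ_ {d})
  ≈ᴼ-isEquivalence = record
    { refl  = λ c x → refl
    ; sym   = λ L≈M c x → sym (L≈M c x)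
    ; trans = λ L≈M M≈N c x → trans (L≈M c x) (M≈N c x)
    }

  +-isAbelianGroup : IsAbelianGroup (_≈ᴼ_ {d}) _++_ [] (-ᴼ_)
  +-isAbelianGroup = record
    { isGroup = record
      { isMonoid = record
        { isSemigroup = record
          { isMagma = record
            { isEquivalence = ≈ᴼ-isEquivalence
            ; ∙-cong = λ {L} {L′} {M} {M′} L≈L′ M≈M′ c x →
                ⟦⟧-++ L M c x ⟨ trans ⟩ cong₂ _+_ (L≈L′ c x) (M≈M′ c x) ⟨ trans ⟩ sym (⟦⟧-++ L′ M′ c x)
            }
          ; assoc = λ L M N c x → cong (λ z → ⟦ z ⟧ c x) (++-assoc L M N)
          }
        ; identity = (λ L c x → refl) , (λ L c x → cong (λ z → ⟦ z ⟧ c x) (++-identityʳ L))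
        }
      ; inverse = (λ L c x → ⟦⟧-++ (-ᴼ L) L c x ⟨ trans ⟩ cong (_+ ⟦ L ⟧ c x) (⟦⟧-neg L c x) ⟨ trans ⟩ ℤP.+-inverseˡ (⟦ L ⟧ c x))
                , (λ L c x → ⟦⟧-++ L (-ᴼ L) c x ⟨ trans ⟩ cong (⟦ L ⟧ c x +_) (⟦⟧-neg L c x) ⟨ trans ⟩ ℤP.+-inverseʳ (⟦ L ⟧ c x))
      ; ⁻¹-cong = λ {L} {M} L≈M c x → ⟦⟧-neg L c x ⟨ trans ⟩ cong -_ (L≈M c x) ⟨ trans ⟩ sym (⟦⟧-neg M c x)
      }
    ; comm = λ L M c x → ⟦⟧-++ L M c x ⟨ trans ⟩ ℤP.+-comm (⟦ L ⟧ c x) _ ⟨ trans ⟩ sym (⟦⟧-++ M L c x)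
    }

  isCommutativeRing : IsCommutativeRing (_≈ᴼ_ {d}) _++_ _*ᴼ_ (-ᴼ_) [] 1ᴼ
  isCommutativeRing = record
    { isRing = record
      { +-isAbelianGroup = +-isAbelianGroup
      ; *-cong = λ {L} {L′} {M} {M′} L≈L′ M≈M′ c x →
          ⟦⟧-* L M c x ⟨ trans ⟩ L≈L′ (⟦ M ⟧ c) x ⟨ trans ⟩ ⟦⟧-cong L′ (M≈M′ c) x ⟨ trans ⟩ sym (⟦⟧-* L′ M′ c x)
      ; *-assoc = λ L M N c x →
          ⟦⟧-* (L *ᴼ M) N c x ⟨ trans ⟩ ⟦⟧-* L M (⟦ N ⟧ c) x ⟨ trans ⟩
          sym (⟦⟧-* L (M *ᴼ N) c x ⟨ trans ⟩ ⟦⟧-cong L (⟦⟧-* M N c) x)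
      ; *-identity = (λ L c x → ⟦⟧-* 1ᴼ L c x ⟨ trans ⟩ ⟦⟧-one (⟦ L ⟧ c) x)
                   , (λ L c x → ⟦⟧-* L 1ᴼ c x ⟨ trans ⟩ ⟦⟧-cong L (⟦⟧-one c) x)
      ; distrib = (λ L M N c x →
                    ⟦⟧-* L (M ++ N) c x ⟨ trans ⟩ ⟦⟧-cong L (⟦⟧-++ M N c) x ⟨ trans ⟩
                    ⟦⟧-+ L (⟦ M ⟧ c) (⟦ N ⟧ c) x ⟨ trans ⟩
                    sym (⟦⟧-++ (L *ᴼ M) (L *ᴼ N) c x ⟨ trans ⟩ cong₂ _+_ (⟦⟧-* L M c x) (⟦⟧-* L N c x)))
                , (λ L M N c x →
                    ⟦⟧-* (M ++ N) L c x ⟨ trans ⟩ ⟦⟧-++ M N (⟦ L ⟧ c) x ⟨ trans ⟩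
                    sym (⟦⟧-++ (M *ᴼ L) (N *ᴼ L) c x ⟨ trans ⟩ cong₂ _+_ (⟦⟧-* M L c x) (⟦⟧-* N L c x)))
      }
    ; *-comm = λ L M c x → ⟦⟧-* L M c x ⟨ trans ⟩ ⟦⟧-comm L M c x ⟨ trans ⟩ sym (⟦⟧-* M L c x)
    }

  Operators : ℕ → CommutativeRing 0ℓ 0ℓ
  Operators d = record { isCommutativeRing = isCommutativeRing {d} }

  ⟦⟧-↭ : ∀ {L L′ : Op d} → L ↭ L′ → ∀ c x → ⟦ L ⟧ c x ≡ ⟦ L′ ⟧ c x
  ⟦⟧-↭ ↭.refl                           c x = refl
  ⟦⟧-↭ (prep (a , u) L↭L′)              c x = cong (a * c (x ⊖ u) +_) (⟦⟧-↭ L↭L′ c x)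
  ⟦⟧-↭ {L′ = _ ∷ _ ∷ L′} (swap (a , u) (b , w) L↭L′) c x =
    cong (λ z → a * c (x ⊖ u) + (b * c (x ⊖ w) + z)) (⟦⟧-↭ L↭L′ c x) ⟨ trans ⟩
    x∙yz≈y∙xz (a * c (x ⊖ u)) (b * c (x ⊖ w)) (⟦ L′ ⟧ c x)
  ⟦⟧-↭ (↭.trans L↭M M↭N)                c x = ⟦⟧-↭ L↭M c x ⟨ trans ⟩ ⟦⟧-↭ M↭N c x

module Differences where
  open Points
  open import Data.Nat using (ℕ)
  open import Data.Integer as ℤ using (0ℤ; _-_)
  open import Data.Integer.Tactic.RingSolver using (solve-∀)
  open import Data.List using (List; []; _∷_; _++_; concat)
  open import Data.List.Membership.Propositional using (_∈_)
  open import Data.List.Relation.Unary.Any using (here; there)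
  open import Function using (_⟨_⟩_)
  open import Relation.Binary.PropositionalEquality using (_≡_; refl; cong; cong₂; trans)

  private variable d : ℕ

  diffProd-++ : ∀ (vs ws : List (Point d)) c x → diffProd (vs ++ ws) c x ≡ diffProd vs (diffProd ws c) x
  diffProd-++ []       ws c x = refl
  diffProd-++ (v ∷ vs) ws c x = cong₂ _-_ (diffProd-++ vs ws c (x ⊖ v)) (diffProd-++ vs ws c x)

  diffProd-zero : ∀ (vs : List (Point d)) {c} → (∀ y → c y ≡ 0ℤ) → ∀ x → diffProd vs c x ≡ 0ℤ
  diffProd-zero []       c≡0 x = c≡0 x
  diffProd-zero (v ∷ vs) c≡0 x = cong₂ _-_ (diffProd-zero vs c≡0 (x ⊖ v)) (diffProd-zero vs c≡0 x)

  diffOp-diffProd : ∀ v (ws : List (Point d)) c x → diffOp v (diffProd ws c) x ≡ diffProd ws (diffOp v c) x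
  diffOp-diffProd v []       c x = refl
  diffOp-diffProd v (w ∷ ws) c x =
    cong (λ y → (g y - g (x ⊖ v)) - (g (x ⊖ w) - g x)) (⊖-comm x v w) ⟨ trans ⟩
    scalar (g ((x ⊖ w) ⊖ v)) (g (x ⊖ v)) (g (x ⊖ w)) (g x) ⟨ trans ⟩
    cong₂ _-_ (diffOp-diffProd v ws c (x ⊖ w)) (diffOp-diffProd v ws c x)
    where
    g = diffProd ws c
    scalar : ∀ a b e f → (a - b) - (e - f) ≡ (a - e) - (b - f)
    scalar = solve-∀

  diffProd-comm : ∀ (vs ws : List (Point d)) c x → diffProd vs (diffProd ws c) x ≡ diffProd ws (diffProd vs c) x
  diffProd-comm []       ws c x = refl
  diffProd-comm (v ∷ vs) ws c x =
    cong₂ _-_ (diffProd-comm vs ws c (x ⊖ v)) (diffProd-comm vs ws c x) ⟨ trans ⟩ diffOp-diffProd v ws (diffProd vs c) x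

  diffProd-concat : ∀ {vs} {vss : List (List (Point d))} {c} → vs ∈ vss → (∀ x → diffProd vs c x ≡ 0ℤ) →
                    ∀ x → diffProd (concat vss) c x ≡ 0ℤ
  diffProd-concat {vs = vs} {vss = _ ∷ vss} {c} (here refl) vs-kills x =
    diffProd-++ vs (concat vss) c x ⟨ trans ⟩ diffProd-comm vs (concat vss) c x ⟨ trans ⟩ diffProd-zero (concat vss) vs-kills x
  diffProd-concat {vss = ws ∷ vss} {c} (there vs∈vss) vs-kills x =
    diffProd-++ ws (concat vss) c x ⟨ trans ⟩ diffProd-zero ws (diffProd-concat vs∈vss vs-kills) x

module Frobenius where
  open import Data.Nat as ℕ using (ℕ; zero; suc; _<_; z<s; s<s)
  import Data.Nat.Properties as ℕP
  open import Data.Nat.Combinatorics using (_C_; nCn≡1; nC1≡n; nCk+nC[k+1]≡[n+1]C[k+1])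
  open import Data.Nat.Divisibility using (_∣_; divides; ∣⇒≤)
  open import Data.Nat.Primality using (Prime; euclidsLemma)
  open import Data.Nat.Tactic.RingSolver using (solve-∀)
  open import Data.Fin using (Fin; zero; suc; toℕ; inject₁; fromℕ)
  open import Data.Fin.Properties using (toℕ-inject₁; toℕ-fromℕ; toℕ<n)
  open import Data.Product using (∃; _,_; proj₁; proj₂)
  open import Data.Sum using (inj₁; inj₂)
  open import Algebra.Bundles using (CommutativeSemiring)
  open import Relation.Nullary using (contradiction)
  open import Relation.Binary.PropositionalEquality as ≡ using (_≡_)
  open import Function using (_⟨_⟩_)
  import Algebra.Properties.Semiring.Mult as SemiringMult
  import Algebra.Properties.Semiring.Exp as SemiringExp
  import Algebra.Properties.CommutativeMonoid.Mult as CommutativeMonoidMult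
  import Algebra.Properties.Monoid.Sum as MonoidSum
  import Algebra.Properties.CommutativeSemigroup as CommutativeSemigroupProperties
  import Algebra.Properties.CommutativeSemiring.Binomial as Binomial
  import Relation.Binary.Reasoning.Setoid as SetoidReasoning

  [1+k]*[1+n]C[1+k]≡[1+n]*nCk : ∀ n k → suc k ℕ.* (suc n C suc k) ≡ suc n ℕ.* (n C k)
  [1+k]*[1+n]C[1+k]≡[1+n]*nCk zero    zero    = ≡.refl
  [1+k]*[1+n]C[1+k]≡[1+n]*nCk zero    (suc k) = ℕP.*-zeroʳ (suc (suc k))
  [1+k]*[1+n]C[1+k]≡[1+n]*nCk (suc n) zero    = ℕP.*-identityˡ _ ⟨ ≡.trans ⟩ nC1≡n (suc (suc n)) ⟨ ≡.trans ⟩ ≡.sym (ℕP.*-identityʳ _)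
  [1+k]*[1+n]C[1+k]≡[1+n]*nCk (suc n) (suc k) = begin
    suc (suc k) ℕ.* (suc (suc n) C suc (suc k))      ≡⟨ ≡.cong (suc (suc k) ℕ.*_) (≡.sym (nCk+nC[k+1]≡[n+1]C[k+1] (suc n) (suc k))) ⟩
    suc (suc k) ℕ.* (A ℕ.+ B)                        ≡⟨ expand k A B ⟩
    (suc k ℕ.* A ℕ.+ A) ℕ.+ suc (suc k) ℕ.* B        ≡⟨ ≡.cong₂ (λ u v → (u ℕ.+ A) ℕ.+ v) ([1+k]*[1+n]C[1+k]≡[1+n]*nCk n k) ([1+k]*[1+n]C[1+k]≡[1+n]*nCk n (suc k)) ⟩
    (suc n ℕ.* (n C k) ℕ.+ A) ℕ.+ suc n ℕ.* (n C suc k) ≡⟨ regroup n (n C k) (n C suc k) A ⟩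
    suc n ℕ.* ((n C k) ℕ.+ (n C suc k)) ℕ.+ A        ≡⟨ ≡.cong (λ z → suc n ℕ.* z ℕ.+ A) (nCk+nC[k+1]≡[n+1]C[k+1] n k) ⟩
    suc n ℕ.* A ℕ.+ A                                ≡⟨ ℕP.+-comm (suc n ℕ.* A) A ⟩
    suc (suc n) ℕ.* A                                ∎
    where
    open ≡.≡-Reasoning
    A = suc n C suc k
    B = suc n C suc (suc k)
    expand : ∀ k A B → suc (suc k) ℕ.* (A ℕ.+ B) ≡ (suc k ℕ.* A ℕ.+ A) ℕ.+ suc (suc k) ℕ.* B
    expand = solve-∀
    regroup : ∀ n x y A → (suc n ℕ.* x ℕ.+ A) ℕ.+ suc n ℕ.* y ≡ suc n ℕ.* (x ℕ.+ y) ℕ.+ A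
    regroup = solve-∀

  p∣pCk : ∀ {p} → Prime p → ∀ {k} → 0 < k → k < p → p ∣ p C k
  p∣pCk {suc p} p-prime {suc k} _ k<p
    with euclidsLemma (suc k) (suc p C suc k) p-prime
           (divides (p C k) ([1+k]*[1+n]C[1+k]≡[1+n]*nCk p k ⟨ ≡.trans ⟩ ℕP.*-comm (suc p) _))
  ... | inj₂ p∣pCk = p∣pCk
  ... | inj₁ p∣k   = contradiction (∣⇒≤ p∣k) (ℕP.<⇒≱ k<p)

  module _ {a ℓ} (S : CommutativeSemiring a ℓ) where
    open CommutativeSemiring S hiding (zero)
    open SemiringMult semiring using (_×_; ×-homo-1; ×-assocˡ; ×-congˡ)
    open SemiringExp semiring using (_^_)
    open CommutativeMonoidMult +-commutativeMonoid using (×-distrib-+)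
    open MonoidSum +-monoid using (sum; sum-init-last)
    open Binomial S using (theorem; binomialTerm)
    open CommutativeSemigroupProperties +-commutativeSemigroup using (x∙yz≈zx∙y)
    open SetoidReasoning setoid

    MultipleOf : ℕ → Carrier → Set _
    MultipleOf p z = ∃ λ r → z ≈ p × r

    sum-multipleOf : ∀ p {n} (t : Fin n → Carrier) → (∀ i → MultipleOf p (t i)) → MultipleOf p (sum t)
    sum-multipleOf p {zero}  t _  = 0# , sym (×-zeroʳ p)
      where
      ×-zeroʳ : ∀ n → n × 0# ≈ 0#
      ×-zeroʳ zero    = refl
      ×-zeroʳ (suc n) = trans (+-identityˡ _) (×-zeroʳ n)
    sum-multipleOf p {suc n} t ts with ts zero | sum-multipleOf p (λ i → t (suc i)) (λ i → ts (suc i))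
    ... | r , t₀≈pr | s , rest≈ps = r + s , trans (+-cong t₀≈pr rest≈ps) (sym (×-distrib-+ r s p))

    binomialTerm-multipleOf : ∀ {q} → let p = suc (suc q) in
                              Prime p → ∀ x y (i : Fin (suc q)) → MultipleOf p (binomialTerm x y p (suc (inject₁ i)))
    binomialTerm-multipleOf {q} p-prime x y i
      with p∣pCk p-prime {suc (toℕ (inject₁ i))} z<s (s<s (≡.subst (_< suc q) (≡.sym (toℕ-inject₁ i)) (toℕ<n i)))
    ... | divides k pCi≡k*p = k × _ , (begin
      binomialTerm x y (suc (suc q)) (suc (inject₁ i))  ≈⟨ ×-congˡ (pCi≡k*p ⟨ ≡.trans ⟩ ℕP.*-comm k (suc (suc q))) ⟩
      (suc (suc q) ℕ.* k) × _               ≈⟨ sym (×-assocˡ _ (suc (suc q)) k) ⟩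
      suc (suc q) × (k × _)                 ∎)

    frobenius : ∀ {p} → Prime p → ∀ x y → ∃ λ r → (x + y) ^ p ≈ (x ^ p + y ^ p) + p × r
    frobenius {p@(suc (suc q))} p-prime x y = r , (begin
      (x + y) ^ p                                        ≈⟨ theorem p x y ⟩
      term zero + sum (λ i → term (suc i))               ≈⟨ +-congˡ (sum-init-last (λ i → term (suc i))) ⟩
      term zero + (sum middle + term (suc (fromℕ (suc q)))) ≈⟨ +-cong (trans (×-homo-1 _) (*-identityˡ _)) (+-cong (proj₂ middle-multipleOf) last≈x^p) ⟩
      y ^ p + (p × r + x ^ p)                            ≈⟨ x∙yz≈zx∙y (y ^ p) (p × r) (x ^ p) ⟩
      (x ^ p + y ^ p) + p × r                            ∎)
      where
      term : Fin (suc p) → Carrier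
      term = binomialTerm x y p
      middle : Fin (suc q) → Carrier
      middle i = term (suc (inject₁ i))

      middle-multipleOf : MultipleOf p (sum middle)
      middle-multipleOf = sum-multipleOf p middle (binomialTerm-multipleOf p-prime x y)
      r = proj₁ middle-multipleOf

      last≈x^p : term (suc (fromℕ (suc q))) ≈ x ^ p
      last≈x^p = begin
        (p C toℕ (suc (fromℕ (suc q)))) × (x ^ toℕ (suc (fromℕ (suc q))) * y ^ (p ℕ.∸ toℕ (suc (fromℕ (suc q)))))
          ≡⟨ ≡.cong (λ n → (p C n) × (x ^ n * y ^ (p ℕ.∸ n))) (≡.cong suc (toℕ-fromℕ (suc q))) ⟩
        (p C p) × (x ^ p * y ^ (p ℕ.∸ p))  ≡⟨ ≡.cong₂ (λ m n → m × (x ^ p * y ^ n)) (nCn≡1 p) (ℕP.n∸n≡0 p) ⟩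
        1 × (x ^ p * 1#)                  ≈⟨ trans (×-homo-1 _) (*-identityʳ _) ⟩
        x ^ p                             ∎

module Fermat where
  open Frobenius
  open import Data.Nat as ℕ using (ℕ; zero; suc)
  open import Data.Nat.Primality using (Prime; prime⇒nonZero)
  open import Data.Integer as ℤ using (ℤ; +_; -[1+_]; 0ℤ; 1ℤ; _+_; _*_; -_; _-_; _^_)
  import Data.Integer.Properties as ℤP
  open import Data.Integer.Tactic.RingSolver using (solve-∀)
  open import Data.Product using (∃; _,_)
  open import Function using (_⟨_⟩_)
  open import Relation.Binary.PropositionalEquality
  import Algebra.Properties.Semiring.Mult as SemiringMult
  import Algebra.Properties.Semiring.Exp as SemiringExp

  frobeniusℤ : ∀ {p} → Prime p → ∀ i j → ∃ λ r → (i + j) ^ p ≡ (i ^ p + j ^ p) + + p * r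
  frobeniusℤ {p} p-prime i j with frobenius ℤP.+-*-commutativeSemiring p-prime i j
  ... | r , eq = r , (sym (^≡^ (i + j) p) ⟨ trans ⟩ eq ⟨ trans ⟩ cong₂ _+_ (cong₂ _+_ (^≡^ i p) (^≡^ j p)) (×≡* p r))
    where
    open SemiringMult ℤP.+-*-semiring using (_×_)
    open SemiringExp ℤP.+-*-semiring renaming (_^_ to _^ₛ_)

    ×≡* : ∀ n i → n × i ≡ + n * i
    ×≡* zero    i = sym (ℤP.*-zeroˡ i)
    ×≡* (suc n) i = cong (λ z → i + z) (×≡* n i) ⟨ trans ⟩ sym (ℤP.*-distribʳ-+ i 1ℤ (+ n) ⟨ trans ⟩ cong (_+ + n * i) (ℤP.*-identityˡ i))

    ^≡^ : ∀ i n → i ^ₛ n ≡ i ^ n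
    ^≡^ i zero    = refl
    ^≡^ i (suc n) = cong (i *_) (^≡^ i n)

  FermatAt : ℕ → ℤ → Set
  FermatAt p i = ∃ λ t → i ^ p ≡ i + + p * t

  module _ {p} (p-prime : Prime p) where

    fermat-0 : FermatAt p 0ℤ
    fermat-0 = 0ℤ , (0^p≡0 p {{prime⇒nonZero p-prime}} ⟨ trans ⟩ sym (ℤP.+-identityˡ _ ⟨ trans ⟩ ℤP.*-zeroʳ (+ p)))
      where
      0^p≡0 : ∀ n → .{{ℕ.NonZero n}} → 0ℤ ^ n ≡ 0ℤ
      0^p≡0 (suc n) = ℤP.*-zeroˡ (0ℤ ^ n)

    fermat-1 : FermatAt p 1ℤ
    fermat-1 = 0ℤ , (ℤP.^-zeroˡ p ⟨ trans ⟩ sym (cong (_+_ 1ℤ) (ℤP.*-zeroʳ (+ p))))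

    fermat-+ : ∀ {i j} → FermatAt p i → FermatAt p j → FermatAt p (i + j)
    fermat-+ {i} {j} (t , i^p≡) (s , j^p≡) with frobeniusℤ p-prime i j
    ... | r , eq = t + s + r , (eq ⟨ trans ⟩ cong₂ (λ x y → x + y + + p * r) i^p≡ j^p≡ ⟨ trans ⟩ regroup i j (+ p) t s r)
      where
      regroup : ∀ i j p t s r → (i + p * t) + (j + p * s) + p * r ≡ (i + j) + p * (t + s + r)
      regroup = solve-∀

    fermat-- : ∀ {i j} → FermatAt p i → FermatAt p j → FermatAt p (i - j)
    fermat-- {i} {j} (t , i^p≡) (s , j^p≡) with frobeniusℤ p-prime (i - j) j
    ... | r , eq = t - s - r , (begin
      (i - j) ^ p                                          ≡⟨ isolate ((i - j) ^ p) (j ^ p) (+ p * r) ⟩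
      ((i - j) ^ p + j ^ p + + p * r) - j ^ p - + p * r     ≡⟨ cong (λ z → z - j ^ p - + p * r) (sym i^p≡[i-j]^p+j^p+pr) ⟩
      i ^ p - j ^ p - + p * r                              ≡⟨ cong₂ (λ x y → x - y - + p * r) i^p≡ j^p≡ ⟩
      (i + + p * t) - (j + + p * s) - + p * r              ≡⟨ regroup i j (+ p) t s r ⟩
      (i - j) + + p * (t - s - r)                          ∎)
      where
      open ≡-Reasoning
      i-j+j≡i : ∀ i j → i - j + j ≡ i
      i-j+j≡i = solve-∀
      isolate : ∀ x y z → x ≡ (x + y + z) - y - z
      isolate = solve-∀
      regroup : ∀ i j p t s r → (i + p * t) - (j + p * s) - p * r ≡ (i - j) + p * (t - s - r)
      regroup = solve-∀
      i^p≡[i-j]^p+j^p+pr : i ^ p ≡ (i - j) ^ p + j ^ p + + p * r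
      i^p≡[i-j]^p+j^p+pr = cong (_^ p) (sym (i-j+j≡i i j)) ⟨ trans ⟩ eq

    fermatℕ : ∀ n → FermatAt p (+ n)
    fermatℕ zero    = fermat-0
    fermatℕ (suc n) = fermat-+ fermat-1 (fermatℕ n)

    fermat : ∀ i → FermatAt p i
    fermat (+ n)     = fermatℕ n
    fermat -[1+ n ]  = fermat-- fermat-0 (fermatℕ (suc n))

module Dilation where
  open Points
  open Operators
  open Frobenius
  open Fermat
  open import Data.Nat as ℕ using (ℕ; zero; suc; _≤_; _<_; z≤n; _!; nonTrivial⇒≢1)
  import Data.Nat.Properties as ℕP
  open import Data.Nat.Divisibility using (_∣_; ∣-trans; m∣m*n; ∣n⇒∣m*n; ∣m+n∣m⇒∣n; ∣1⇒≡1; m≤n⇒m!∣n!)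
  open import Data.Nat.Primality using (Prime; _Rough_; rough∧∣⇒rough; rough⇒≤; prime⇒nonTrivial)
  open import Data.Nat.Primality.Factorisation using (factorise; PrimeFactorisation)
  open import Data.Nat.Divisibility.Core using (hasNonTrivialDivisor)
  open import Data.List.Membership.Propositional using (_∈_)
  open import Data.Nat.ListAction using (product)
  open import Data.Nat.ListAction.Properties using (∈⇒∣product)
  open import Data.Integer as ℤ using (+_; +[1+_]; -[1+_]; 0ℤ; 1ℤ; _+_; _*_; -_; _-_; _^_; ∣_∣)
  import Data.Integer.Properties as ℤP
  open import Data.Integer.Tactic.RingSolver using (solve-∀)
  open import Data.List using ([]; _∷_; _++_; map)
  open import Data.List.Relation.Unary.All as All using (All; []; _∷_)
  open import Data.Product using (∃; _×_; _,_)
  open import Function using (_⟨_⟩_)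
  open import Relation.Nullary using (contradiction)
  open import Relation.Binary.PropositionalEquality
  import Algebra.Properties.Semiring.Mult as SemiringMult
  import Algebra.Properties.Semiring.Exp as SemiringExp

  private variable d : ℕ

  dilate : ℕ → Op d → Op d
  dilate n = map (λ (a , u) → a , + n · u)

  ‖_‖₁ : Op d → ℕ
  ‖ []          ‖₁ = 0
  ‖ (a , u) ∷ L ‖₁ = ∣ a ∣ ℕ.+ ‖ L ‖₁

  ‖dilate‖₁ : ∀ n (L : Op d) → ‖ dilate n L ‖₁ ≡ ‖ L ‖₁
  ‖dilate‖₁ n []            = refl
  ‖dilate‖₁ n ((a , u) ∷ L) = cong (∣ a ∣ ℕ.+_) (‖dilate‖₁ n L)

  dilate-1 : ∀ (L : Op d) → dilate 1 L ≡ L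
  dilate-1 []            = refl
  dilate-1 ((a , u) ∷ L) = cong₂ _∷_ (cong (a ,_) (·-identityˡ u)) (dilate-1 L)

  dilate-* : ∀ m n (L : Op d) → dilate (m ℕ.* n) L ≡ dilate m (dilate n L)
  dilate-* m n []            = refl
  dilate-* m n ((a , u) ∷ L) =
    cong₂ _∷_ (cong (a ,_) (cong (_· u) (ℤP.pos-* m n) ⟨ trans ⟩ sym (·-assoc (+ m) (+ n) u))) (dilate-* m n L)

  p≤∣p*t∣ : ∀ p t {k} → ∣ t ∣ ≡ suc k → p ≤ ∣ + p * t ∣
  p≤∣p*t∣ p t {k} ∣t∣≡1+k = ℕP.≤-trans (ℕP.m≤m*n p (suc k)) (ℕP.≤-reflexive (sym (ℤP.abs-* (+ p) t ⟨ trans ⟩ cong (p ℕ.*_) ∣t∣≡1+k)))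

  ∣p*t∣<p⇒p*t≡0 : ∀ p t → ∣ + p * t ∣ < p → + p * t ≡ 0ℤ
  ∣p*t∣<p⇒p*t≡0 p (+ zero) _ = ℤP.*-zeroʳ (+ p)
  ∣p*t∣<p⇒p*t≡0 p t@(+[1+ k ]) ∣pt∣<p = contradiction (p≤∣p*t∣ p t refl) (ℕP.<⇒≱ ∣pt∣<p)
  ∣p*t∣<p⇒p*t≡0 p t@(-[1+ k ]) ∣pt∣<p = contradiction (p≤∣p*t∣ p t refl) (ℕP.<⇒≱ ∣pt∣<p)

  module _ {d : ℕ} where
    open CommutativeRing (Operators d) using (semiring; commutativeSemiring)
    open SemiringMult semiring using () renaming (_×_ to _×ᴼ_)
    open SemiringExp semiring using () renaming (_^_ to _^ᴼ_)

    ⟦⟧-× : ∀ n (L : Op d) c x → ⟦ n ×ᴼ L ⟧ c x ≡ + n * ⟦ L ⟧ c x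
    ⟦⟧-× zero    L c x = sym (ℤP.*-zeroˡ (⟦ L ⟧ c x))
    ⟦⟧-× (suc n) L c x =
      ⟦⟧-++ L (n ×ᴼ L) c x ⟨ trans ⟩ cong (λ z → ⟦ L ⟧ c x + z) (⟦⟧-× n L c x) ⟨ trans ⟩ scalar (⟦ L ⟧ c x) (+ n)
      where
      scalar : ∀ z n → z + n * z ≡ (1ℤ + n) * z
      scalar = solve-∀

    ⟦monomial^⟧ : ∀ n a u (c : Config d) x → ⟦ ((a , u) ∷ []) ^ᴼ n ⟧ c x ≡ a ^ n * c (x ⊖ (+ n · u))
    ⟦monomial^⟧ zero    a u c x = ⟦⟧-one c x ⟨ trans ⟩ sym (ℤP.*-identityˡ _ ⟨ trans ⟩ cong c (cong (x ⊖_) (·-zeroˡ u) ⟨ trans ⟩ ⊖-identityʳ x))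
    ⟦monomial^⟧ (suc n) a u c x = begin
      ⟦ ((a , u) ∷ []) *ᴼ (((a , u) ∷ []) ^ᴼ n) ⟧ c x    ≡⟨ ⟦⟧-* ((a , u) ∷ []) (((a , u) ∷ []) ^ᴼ n) c x ⟨ trans ⟩ ℤP.+-identityʳ _ ⟩
      a * ⟦ ((a , u) ∷ []) ^ᴼ n ⟧ c (x ⊖ u)             ≡⟨ cong (a *_) (⟦monomial^⟧ n a u c (x ⊖ u)) ⟩
      a * (a ^ n * c ((x ⊖ u) ⊖ (+ n · u)))              ≡⟨ sym (ℤP.*-assoc a (a ^ n) _) ⟩
      a ^ suc n * c ((x ⊖ u) ⊖ (+ n · u))                ≡⟨ cong (λ y → a ^ suc n * c y) (⊖-⊖ x u (+ n · u) ⟨ trans ⟩ cong (x ⊖_) (⊕-·-suc (+ n) u)) ⟩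
      a ^ suc n * c (x ⊖ (+ suc n · u))                  ∎
      where open ≡-Reasoning

    frobeniusᴼ : ∀ {p} → Prime p → ∀ (L : Op d) → ∃ λ r → ∀ c x → ⟦ L ^ᴼ p ⟧ c x ≡ ⟦ dilate p L ⟧ c x + + p * ⟦ r ⟧ c x
    frobeniusᴼ {suc q} p-prime [] = [] , λ c x → sym (ℤP.+-identityˡ _ ⟨ trans ⟩ ℤP.*-zeroʳ (+ suc q))
    frobeniusᴼ {p} p-prime ((a , u) ∷ L)
      with frobeniusᴼ p-prime L | frobenius commutativeSemiring p-prime ((a , u) ∷ []) L | fermat p-prime a
    ... | r₂ , L^p≡ | r₁ , frob | t , a^p≡ = (t , + p · u) ∷ (r₂ ++ r₁) , split
      where
      regroup : ∀ a p t z D r₂ r₁ → ((a + p * t) * z + (D + p * r₂)) + p * r₁ ≡ (a * z + D) + p * (t * z + (r₂ + r₁))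
      regroup = solve-∀

      split : ∀ c x → ⟦ ((a , u) ∷ L) ^ᴼ p ⟧ c x ≡ ⟦ dilate p ((a , u) ∷ L) ⟧ c x + + p * ⟦ (t , + p · u) ∷ (r₂ ++ r₁) ⟧ c x
      split c x = begin
        ⟦ ((a , u) ∷ L) ^ᴼ p ⟧ c x
          ≡⟨ frob c x ⟨ trans ⟩ ⟦⟧-++ (((a , u) ∷ []) ^ᴼ p ++ L ^ᴼ p) (p ×ᴼ r₁) c x ⟩
        ⟦ ((a , u) ∷ []) ^ᴼ p ++ L ^ᴼ p ⟧ c x + ⟦ p ×ᴼ r₁ ⟧ c x
          ≡⟨ cong₂ _+_ (⟦⟧-++ (((a , u) ∷ []) ^ᴼ p) (L ^ᴼ p) c x) (⟦⟧-× p r₁ c x) ⟩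
        (⟦ ((a , u) ∷ []) ^ᴼ p ⟧ c x + ⟦ L ^ᴼ p ⟧ c x) + + p * ⟦ r₁ ⟧ c x
          ≡⟨ cong₂ (λ y z → (y + z) + + p * ⟦ r₁ ⟧ c x) (⟦monomial^⟧ p a u c x ⟨ trans ⟩ cong (_* c x⊖pu) a^p≡) (L^p≡ c x) ⟩
        ((a + + p * t) * c x⊖pu + (⟦ dilate p L ⟧ c x + + p * ⟦ r₂ ⟧ c x)) + + p * ⟦ r₁ ⟧ c x
          ≡⟨ regroup a (+ p) t (c x⊖pu) (⟦ dilate p L ⟧ c x) (⟦ r₂ ⟧ c x) (⟦ r₁ ⟧ c x) ⟩
        (a * c x⊖pu + ⟦ dilate p L ⟧ c x) + + p * (t * c x⊖pu + (⟦ r₂ ⟧ c x + ⟦ r₁ ⟧ c x))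
          ≡⟨ cong (λ z → (a * c x⊖pu + ⟦ dilate p L ⟧ c x) + + p * (t * c x⊖pu + z)) (sym (⟦⟧-++ r₂ r₁ c x)) ⟩
        ⟦ dilate p ((a , u) ∷ L) ⟧ c x + + p * ⟦ (t , + p · u) ∷ (r₂ ++ r₁) ⟧ c x
          ∎
        where
        open ≡-Reasoning
        x⊖pu = x ⊖ (+ p · u)

    ∣⟦⟧∣≤ : ∀ {C} {c : Config d} → (∀ y → ∣ c y ∣ ≤ C) → ∀ L x → ∣ ⟦ L ⟧ c x ∣ ≤ ‖ L ‖₁ ℕ.* C
    ∣⟦⟧∣≤         c≤C []            x = z≤n
    ∣⟦⟧∣≤ {C} {c} c≤C ((a , u) ∷ L) x = begin
      ∣ a * c (x ⊖ u) + ⟦ L ⟧ c x ∣         ≤⟨ ℤP.∣i+j∣≤∣i∣+∣j∣ (a * c (x ⊖ u)) _ ⟩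
      ∣ a * c (x ⊖ u) ∣ ℕ.+ ∣ ⟦ L ⟧ c x ∣   ≡⟨ cong (ℕ._+ ∣ ⟦ L ⟧ c x ∣) (ℤP.abs-* a (c (x ⊖ u))) ⟩
      ∣ a ∣ ℕ.* ∣ c (x ⊖ u) ∣ ℕ.+ ∣ ⟦ L ⟧ c x ∣ ≤⟨ ℕP.+-mono-≤ (ℕP.*-monoʳ-≤ ∣ a ∣ (c≤C (x ⊖ u))) (∣⟦⟧∣≤ c≤C L x) ⟩
      ∣ a ∣ ℕ.* C ℕ.+ ‖ L ‖₁ ℕ.* C          ≡⟨ sym (ℕP.*-distribʳ-+ C ∣ a ∣ ‖ L ‖₁) ⟩
      ‖ (a , u) ∷ L ‖₁ ℕ.* C                ∎
      where open ℕP.≤-Reasoning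

    dilate-prime : ∀ {p C} {c : Config d} → Prime p → (∀ y → ∣ c y ∣ ≤ C) →
                   ∀ L → ‖ L ‖₁ ℕ.* C < p → Annihilatesℤ L c → Annihilatesℤ (dilate p L) c
    dilate-prime {p@(suc q)} {C} {c} p-prime c≤C L ‖L‖C<p Lc≡0 x with frobeniusᴼ p-prime L
    ... | r , L^p≡ = D≡p*[-R] ⟨ trans ⟩ ∣p*t∣<p⇒p*t≡0 p (- ⟦ r ⟧ c x) (subst (λ z → ∣ z ∣ < p) D≡p*[-R] ∣D∣<p)
      where
      D = ⟦ dilate p L ⟧ c x
      ∣D∣<p : ∣ D ∣ < p
      ∣D∣<p = ℕP.≤-<-trans (subst (λ n → ∣ D ∣ ≤ n ℕ.* C) (‖dilate‖₁ p L) (∣⟦⟧∣≤ c≤C (dilate p L) x)) ‖L‖C<p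
      D+pR≡0 : D + + p * ⟦ r ⟧ c x ≡ 0ℤ
      D+pR≡0 = sym (L^p≡ c x) ⟨ trans ⟩ annihilates-*ˡ L (L ^ᴼ q) Lc≡0 x
      D≡p*[-R] : D ≡ + p * (- ⟦ r ⟧ c x)
      D≡p*[-R] = isolate D (+ p) (⟦ r ⟧ c x) ⟨ trans ⟩ cong (λ z → z + + p * (- ⟦ r ⟧ c x)) D+pR≡0 ⟨ trans ⟩ ℤP.+-identityˡ _
        where
        isolate : ∀ D p R → D ≡ (D + p * R) + p * (- R)
        isolate = solve-∀

    dilate-primes : ∀ {C} {c : Config d} → (∀ y → ∣ c y ∣ ≤ C) → ∀ ps L →
                    All (λ p → Prime p × ‖ L ‖₁ ℕ.* C < p) ps → Annihilatesℤ L c → Annihilatesℤ (dilate (product ps) L) c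
    dilate-primes c≤C []       L []                         Lc≡0 = subst (λ M → Annihilatesℤ M _) (sym (dilate-1 L)) Lc≡0
    dilate-primes {C} c≤C (p ∷ ps) L ((p-prime , B<p) ∷ ps-ok) Lc≡0 =
      subst (λ M → Annihilatesℤ M _) (sym (dilate-* p (product ps) L))
        (dilate-prime p-prime c≤C (dilate (product ps) L) (subst (λ n → n ℕ.* C < p) (sym (‖dilate‖₁ (product ps) L)) B<p)
          (dilate-primes c≤C ps L ps-ok Lc≡0))

    dilate-rough : ∀ {C} {c : Config d} → (∀ y → ∣ c y ∣ ≤ C) → ∀ L {n} .{{_ : ℕ.NonZero n}} →
                   suc (‖ L ‖₁ ℕ.* C) Rough n → Annihilatesℤ L c → Annihilatesℤ (dilate n L) c
    dilate-rough c≤C L {n} rough Lc≡0 =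
      subst (λ m → Annihilatesℤ (dilate m L) _) (sym isFactorisation)
        (dilate-primes c≤C factors L (All.tabulate large-prime) Lc≡0)
      where
      open PrimeFactorisation (factorise n)
      large-prime : ∀ {p} → p ∈ factors → Prime p × _ < p
      large-prime p∈factors = p-prime , rough⇒≤ {{prime⇒nonTrivial p-prime}} (rough∧∣⇒rough rough (subst (_ ∣_) (sym isFactorisation) (∈⇒∣product p∈factors)))
        where p-prime = All.lookup factorsPrime p∈factors

  n∣n! : ∀ n → .{{ℕ.NonZero n}} → n ∣ n !
  n∣n! (suc n) = m∣m*n (n !)

  rough-1+k*B! : ∀ B k → suc B Rough suc (k ℕ.* B !)
  rough-1+k*B! B k (hasNonTrivialDivisor {e} e<1+B e∣1+kB!) = nonTrivial⇒≢1 (∣1⇒≡1 (∣m+n∣m⇒∣n e∣kB!+1 e∣kB!))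
    where
    e∣kB!+1 : e ∣ k ℕ.* B ! ℕ.+ 1
    e∣kB!+1 = subst (e ∣_) (ℕP.+-comm 1 _) e∣1+kB!
    e∣kB! : e ∣ k ℕ.* B !
    e∣kB! = ∣n⇒∣m*n k (∣-trans (n∣n! e {{ℕ.nonTrivial⇒nonZero e}}) (m≤n⇒m!∣n! (ℕP.≤-pred e<1+B)))

module Interpolation where
  open Points
  open Operators
  open Dilation
  open import Data.Nat as ℕ using (ℕ; suc)
  open import Data.Integer as ℤ using (ℤ; +_; 0ℤ; 1ℤ; _+_; _*_; -_; _-_)
  import Data.Integer.Properties as ℤP
  open import Data.Integer.Tactic.RingSolver using (solve-∀)
  open import Data.List using (List; []; _∷_; _++_; map)
  open import Data.List.Membership.Propositional using (_∈_)
  open import Data.List.Relation.Unary.All as All using (All; []; _∷_)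
  open import Data.List.Relation.Unary.Any using (here; there)
  open import Data.Product using (_×_; _,_; proj₂)
  open import Function using (_⟨_⟩_)
  open import Relation.Binary.PropositionalEquality

  -- With Z w = X^(M (w - u)): E (a , w) k = a X^w (Z w)^k, Π J w = Π_{j ∈ J} (Z j - Z w) and
  -- H J k L = Σ_{(a , w) ∈ L} E (a , w) k · Π J w. Then H [] k L is a translate of L^(1 + k M), and
  -- H (j ∷ J) k L = Z j · H J k L - H J (1 + k) L, so all H J k L annihilate c as soon as the
  -- dilations do; in H J 0 ((b , u) ∷ J) every summand but b X^u Π J u vanishes.
  module Terms {d} (M : ℕ) (u : Point d) where

    m : ℤ
    m = + M

    Z : Point d → Op d
    Z w = (1ℤ , m · (w ⊖ u)) ∷ []

    E : ℤ × Point d → ℕ → Op d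
    E (a , w) k = (a , w ⊕ (+ k * m) · (w ⊖ u)) ∷ []

    Π : Op d → Point d → Op d
    Π []            w = 1ᴼ
    Π ((_ , j) ∷ J) w = (Z j -ᴼ Z w) *ᴼ Π J w

    H : Op d → ℕ → Op d → Op d
    H J k []      = []
    H J k (t ∷ L) = E t k *ᴼ Π J (proj₂ t) ++ H J k L

    differences : Op d → List (Point d)
    differences = map (λ (_ , w) → m · (w ⊖ u))

    ⟦Z⟧ : ∀ w g x → ⟦ Z w ⟧ g x ≡ g (x ⊖ (m · (w ⊖ u)))
    ⟦Z⟧ w g x = ℤP.+-identityʳ _ ⟨ trans ⟩ ℤP.*-identityˡ _

    ⟦E⟧-suc : ∀ t k g x → ⟦ E t (suc k) ⟧ g x ≡ ⟦ Z (proj₂ t) ⟧ (⟦ E t k ⟧ g) x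
    ⟦E⟧-suc (a , w) k g x =
      cong (λ y → a * g y + 0ℤ) (⊖-⊕-·-⊖-suc (+ k) m x w u) ⟨ trans ⟩ sym (⟦Z⟧ w (⟦ E (a , w) k ⟧ g) x)

    ⟦E*Π⟧-step : ∀ t a j J k c x → ⟦ E t k *ᴼ Π ((a , j) ∷ J) (proj₂ t) ⟧ c x
                                   ≡ ⟦ Z j ⟧ (⟦ E t k *ᴼ Π J (proj₂ t) ⟧ c) x - ⟦ E t (suc k) *ᴼ Π J (proj₂ t) ⟧ c x
    ⟦E*Π⟧-step t a j J k c x = begin
      ⟦ Eₖ *ᴼ ((Z j -ᴼ Z w) *ᴼ P) ⟧ c x              ≡⟨ ⟦⟧-* Eₖ ((Z j -ᴼ Z w) *ᴼ P) c x ⟩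
      ⟦ Eₖ ⟧ (⟦ (Z j -ᴼ Z w) *ᴼ P ⟧ c) x             ≡⟨ ⟦⟧-cong Eₖ (λ y → ⟦⟧-* (Z j -ᴼ Z w) P c y ⟨ trans ⟩ ⟦⟧--ᴼ (Z j) (Z w) g y) x ⟩
      ⟦ Eₖ ⟧ (λ y → ⟦ Z j ⟧ g y - ⟦ Z w ⟧ g y) x     ≡⟨ ⟦⟧-- Eₖ (⟦ Z j ⟧ g) (⟦ Z w ⟧ g) x ⟩
      ⟦ Eₖ ⟧ (⟦ Z j ⟧ g) x - ⟦ Eₖ ⟧ (⟦ Z w ⟧ g) x     ≡⟨ cong₂ _-_ (⟦⟧-comm Eₖ (Z j) g x) (⟦⟧-comm Eₖ (Z w) g x ⟨ trans ⟩ sym (⟦E⟧-suc t k g x)) ⟩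
      ⟦ Z j ⟧ (⟦ Eₖ ⟧ g) x - ⟦ E t (suc k) ⟧ g x      ≡⟨ cong₂ _-_ (⟦⟧-cong (Z j) (λ y → sym (⟦⟧-* Eₖ P c y)) x) (sym (⟦⟧-* (E t (suc k)) P c x)) ⟩
      ⟦ Z j ⟧ (⟦ Eₖ *ᴼ P ⟧ c) x - ⟦ E t (suc k) *ᴼ P ⟧ c x ∎
      where
      open ≡-Reasoning
      w  = proj₂ t
      Eₖ = E t k
      P  = Π J w
      g  = ⟦ P ⟧ c

    ⟦H⟧-step : ∀ j J k L c x → ⟦ H (j ∷ J) k L ⟧ c x ≡ ⟦ Z (proj₂ j) ⟧ (⟦ H J k L ⟧ c) x - ⟦ H J (suc k) L ⟧ c x
    ⟦H⟧-step j J k []      c x = sym (cong (_- 0ℤ) (⟦⟧-zero (Z (proj₂ j)) x))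
    ⟦H⟧-step j@(a , j′) J k (t ∷ L) c x = begin
      ⟦ E t k *ᴼ Π (j ∷ J) w ++ H (j ∷ J) k L ⟧ c x
        ≡⟨ ⟦⟧-++ (E t k *ᴼ Π (j ∷ J) w) (H (j ∷ J) k L) c x ⟩
      ⟦ E t k *ᴼ Π (j ∷ J) w ⟧ c x + ⟦ H (j ∷ J) k L ⟧ c x
        ≡⟨ cong₂ _+_ (⟦E*Π⟧-step t a j′ J k c x) (⟦H⟧-step j J k L c x) ⟩
      (⟦ Z j′ ⟧ (⟦ A ⟧ c) x - ⟦ A′ ⟧ c x) + (⟦ Z j′ ⟧ (⟦ B ⟧ c) x - ⟦ B′ ⟧ c x)
        ≡⟨ regroup (⟦ Z j′ ⟧ (⟦ A ⟧ c) x) (⟦ A′ ⟧ c x) (⟦ Z j′ ⟧ (⟦ B ⟧ c) x) (⟦ B′ ⟧ c x) ⟩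
      (⟦ Z j′ ⟧ (⟦ A ⟧ c) x + ⟦ Z j′ ⟧ (⟦ B ⟧ c) x) - (⟦ A′ ⟧ c x + ⟦ B′ ⟧ c x)
        ≡⟨ cong₂ _-_ (sym (⟦⟧-+ (Z j′) (⟦ A ⟧ c) (⟦ B ⟧ c) x) ⟨ trans ⟩ ⟦⟧-cong (Z j′) (λ y → sym (⟦⟧-++ A B c y)) x)
                     (sym (⟦⟧-++ A′ B′ c x)) ⟩
      ⟦ Z j′ ⟧ (⟦ A ++ B ⟧ c) x - ⟦ A′ ++ B′ ⟧ c x
        ∎
      where
      open ≡-Reasoning
      w  = proj₂ t
      A  = E t k *ᴼ Π J w
      A′ = E t (suc k) *ᴼ Π J w
      B  = H J k L
      B′ = H J (suc k) L
      regroup : ∀ p q r s → (p - q) + (r - s) ≡ (p + r) - (q + s)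
      regroup = solve-∀

    ⟦H⟧-base : ∀ k L c x → ⟦ H [] k L ⟧ c x ≡ ⟦ dilate (suc (k ℕ.* M)) L ⟧ c (x ⊕ (+ k * m) · u)
    ⟦H⟧-base k []            c x = refl
    ⟦H⟧-base k ((a , w) ∷ L) c x = ⟦⟧-++ (E (a , w) k *ᴼ 1ᴼ) (H [] k L) c x ⟨ trans ⟩ cong₂ _+_ term (⟦H⟧-base k L c x)
      where
      term : ⟦ E (a , w) k *ᴼ 1ᴼ ⟧ c x ≡ a * c ((x ⊕ (+ k * m) · u) ⊖ (+ suc (k ℕ.* M) · w))
      term = ⟦⟧-* (E (a , w) k) 1ᴼ c x ⟨ trans ⟩ ℤP.+-identityʳ _ ⟨ trans ⟩ cong (a *_) (⟦⟧-one c _ ⟨ trans ⟩ cong c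
               (⊖-⊕-·-⊖ (+ k * m) x w u ⟨ trans ⟩ cong (λ n → (x ⊕ (+ k * m) · u) ⊖ (n · w)) (cong (_+_ 1ℤ) (sym (ℤP.pos-* k M)))))

    module _ {c : Config d} (L : Op d) (dilates : ∀ k → Annihilatesℤ (dilate (suc (k ℕ.* M)) L) c) where

      annihilates-H : ∀ J k → Annihilatesℤ (H J k L) c
      annihilates-H []      k x = ⟦H⟧-base k L c x ⟨ trans ⟩ dilates k _
      annihilates-H (j ∷ J) k x =
        ⟦H⟧-step j J k L c x ⟨ trans ⟩
        cong₂ _-_ (⟦⟧-cong (Z (proj₂ j)) (annihilates-H J k) x ⟨ trans ⟩ ⟦⟧-zero (Z (proj₂ j)) x) (annihilates-H J (suc k) x)

    ⟦Π⟧-vanishes : ∀ {t} {J} → t ∈ J → ∀ g x → ⟦ Π J (proj₂ t) ⟧ g x ≡ 0ℤ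
    ⟦Π⟧-vanishes {_ , w} {(_ , .w) ∷ J} (here refl) g x =
      ⟦⟧-* (Z w -ᴼ Z w) (Π J w) g x ⟨ trans ⟩ ⟦⟧--ᴼ (Z w) (Z w) (⟦ Π J w ⟧ g) x ⟨ trans ⟩ ℤP.+-inverseʳ (⟦ Z w ⟧ (⟦ Π J w ⟧ g) x)
    ⟦Π⟧-vanishes {_ , w} {(_ , j) ∷ J} (there t∈J) g x =
      ⟦⟧-* (Z j -ᴼ Z w) (Π J w) g x ⟨ trans ⟩ ⟦⟧-cong (Z j -ᴼ Z w) (⟦Π⟧-vanishes t∈J g) x ⟨ trans ⟩ ⟦⟧-zero (Z j -ᴼ Z w) x

    ⟦H⟧-vanishes : ∀ J k L → All (_∈ J) L → ∀ c x → ⟦ H J k L ⟧ c x ≡ 0ℤ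
    ⟦H⟧-vanishes J k []            []           c x = refl
    ⟦H⟧-vanishes J k ((a , w) ∷ L) (t∈J ∷ L⊆J) c x =
      ⟦⟧-++ (E (a , w) k *ᴼ Π J w) (H J k L) c x ⟨ trans ⟩
      cong₂ _+_ (⟦⟧-* (E (a , w) k) (Π J w) c x ⟨ trans ⟩ cong (λ z → a * z + 0ℤ) (⟦Π⟧-vanishes t∈J c _) ⟨ trans ⟩ ℤP.+-identityʳ _ ⟨ trans ⟩ ℤP.*-zeroʳ a)
                (⟦H⟧-vanishes J k L L⊆J c x)

    ⟦Π⟧-at-u : ∀ J g x → ⟦ Π J u ⟧ g x ≡ diffProd (differences J) g x
    ⟦Π⟧-at-u []            g x = ⟦⟧-one g x
    ⟦Π⟧-at-u ((_ , j) ∷ J) g x = begin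
      ⟦ (Z j -ᴼ Z u) *ᴼ Π J u ⟧ g x                  ≡⟨ ⟦⟧-* (Z j -ᴼ Z u) (Π J u) g x ⟨ trans ⟩ ⟦⟧--ᴼ (Z j) (Z u) h x ⟩
      ⟦ Z j ⟧ h x - ⟦ Z u ⟧ h x                      ≡⟨ cong₂ _-_ (⟦Z⟧ j h x) (⟦Z⟧ u h x ⟨ trans ⟩ cong (λ v → h (x ⊖ v)) (·-⊖-self m u) ⟨ trans ⟩ cong h (⊖-identityʳ x)) ⟩
      h (x ⊖ (m · (j ⊖ u))) - h x                    ≡⟨ cong₂ _-_ (⟦Π⟧-at-u J g _) (⟦Π⟧-at-u J g x) ⟩
      diffProd (differences ((0ℤ , j) ∷ J)) g x      ∎
      where
      open ≡-Reasoning
      h = ⟦ Π J u ⟧ g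

  interpolation : ∀ {d} {c : Config d} M b u (J : Op d) →
                  (∀ k → Annihilatesℤ (dilate (suc (k ℕ.* M)) ((b , u) ∷ J)) c) →
                  ∀ x → b * diffProd (Terms.differences M u J) c x ≡ 0ℤ
  interpolation {c = c} M b u J dilates x = begin
    b * diffProd (differences J) c x                                  ≡⟨ cong (b *_) (sym (⟦Π⟧-at-u J c x)) ⟩
    b * ⟦ Π J u ⟧ c x                                                ≡⟨ cong (λ y → b * ⟦ Π J u ⟧ c y) (sym (⊕-⊖-cancel x u)) ⟩
    b * ⟦ Π J u ⟧ c ((x ⊕ u) ⊖ u)                                    ≡⟨ cong (λ v → b * ⟦ Π J u ⟧ c ((x ⊕ u) ⊖ v)) (sym (⊕-·-⊖-self (+ 0 * m) u)) ⟩
    b * ⟦ Π J u ⟧ c ((x ⊕ u) ⊖ (u ⊕ (+ 0 * m) · (u ⊖ u)))            ≡⟨ sym (ℤP.+-identityʳ _ ⟨ trans ⟩ ℤP.+-identityʳ _) ⟩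
    (b * ⟦ Π J u ⟧ c ((x ⊕ u) ⊖ (u ⊕ (+ 0 * m) · (u ⊖ u))) + 0ℤ) + 0ℤ ≡⟨ sym (cong₂ _+_ (⟦⟧-* (E (b , u) 0) (Π J u) c (x ⊕ u)) (⟦H⟧-vanishes J 0 J (All.tabulate (λ t∈J → t∈J)) c (x ⊕ u))) ⟩
    ⟦ E (b , u) 0 *ᴼ Π J u ⟧ c (x ⊕ u) + ⟦ H J 0 J ⟧ c (x ⊕ u)      ≡⟨ sym (⟦⟧-++ (E (b , u) 0 *ᴼ Π J u) (H J 0 J) c (x ⊕ u)) ⟩
    ⟦ H J 0 ((b , u) ∷ J) ⟧ c (x ⊕ u)                                 ≡⟨ annihilates-H ((b , u) ∷ J) dilates J 0 (x ⊕ u) ⟩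
    0ℤ                                                               ∎
    where
    open Terms M u
    open ≡-Reasoning

module IntegerAnnihilators where
  open Points
  open Operators
  open Dilation
  open Interpolation
  open import Data.Nat as ℕ using (ℕ; suc; _≤_; _!)
  import Data.Nat.Properties as ℕP
  open import Data.Integer as ℤ using (ℤ; +_; 0ℤ; _*_; ∣_∣)
  import Data.Integer.Properties as ℤP
  open import Data.List using (List; []; _∷_; _++_; [_]; map)
  open import Data.List.Properties using (map-++)
  open import Data.List.Membership.Propositional using (_∈_; _∉_)
  open import Data.List.Membership.Propositional.Properties using (∈-∃++; ∈-++⁺ʳ)
  open import Data.List.Relation.Unary.All as All using (All; []; _∷_)
  open import Data.List.Relation.Unary.Any using (here; there)
  open import Data.List.Relation.Unary.Unique.Propositional using (Unique; []; _∷_)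
  open import Data.List.Relation.Unary.Unique.Propositional.Properties using (Unique[x∷xs]⇒x∉xs)
  open import Data.List.Relation.Binary.Permutation.Propositional.Properties using (shift)
  open import Data.Product using (_,_; proj₁; proj₂)
  open import Data.Sum using (inj₁; inj₂)
  open import Function using (_⟨_⟩_)
  open import Relation.Binary.PropositionalEquality

  private variable
    d : ℕ
    A : Set

  Unique[xs++v∷ys]⇒v∉xs++ys : ∀ (xs : List A) {v ys} → Unique (xs ++ v ∷ ys) → v ∉ xs ++ ys
  Unique[xs++v∷ys]⇒v∉xs++ys []       unique         = Unique[x∷xs]⇒x∉xs unique
  Unique[xs++v∷ys]⇒v∉xs++ys (x ∷ xs) (x∉ ∷ unique) (here refl) = All.lookup x∉ (∈-++⁺ʳ xs (here refl)) refl
  Unique[xs++v∷ys]⇒v∉xs++ys (x ∷ xs) (x∉ ∷ unique) (there v∈) = Unique[xs++v∷ys]⇒v∉xs++ys xs unique v∈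

  differences-nonzero : ∀ M → .{{ℕ.NonZero M}} → ∀ (u : Point d) J → u ∉ map proj₂ J →
                        All (λ v → v ≢ origin d) (Terms.differences M u J)
  differences-nonzero M u []            u∉J = []
  differences-nonzero M u ((a , w) ∷ J) u∉J = nonzero ∷ differences-nonzero M u J (λ u∈J → u∉J (there u∈J))
    where
    nonzero : + M · (w ⊖ u) ≢ origin _
    nonzero eq with ·-⊖≡origin (+ M) w u eq
    ... | inj₁ M≡0 = ℕ.≢-nonZero⁻¹ M (ℤP.+-injective M≡0)
    ... | inj₂ w≡u = u∉J (here (sym w≡u))

  module _ {d} {C : ℕ} {c : Config d} (c≤C : ∀ y → ∣ c y ∣ ≤ C) where

    differences-annihilate : ∀ b u J → b ≢ 0ℤ → Annihilatesℤ ((b , u) ∷ J) c →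
      ∀ x → diffProd (Terms.differences ((‖ (b , u) ∷ J ‖₁ ℕ.* C) !) u J) c x ≡ 0ℤ
    differences-annihilate b u J b≢0 annihilates x =
      ℤP.*-cancelˡ-≡ b _ 0ℤ {{ℤ.≢-nonZero b≢0}} (interpolation M b u J dilates x ⟨ trans ⟩ sym (ℤP.*-zeroʳ b))
      where
      B = ‖ (b , u) ∷ J ‖₁ ℕ.* C
      M = B !
      dilates : ∀ k → Annihilatesℤ (dilate (suc (k ℕ.* M)) ((b , u) ∷ J)) c
      dilates k = dilate-rough c≤C ((b , u) ∷ J) (rough-1+k*B! B k) annihilates

  directions : ℕ → ∀ {t} (L : Op d) → t ∈ L → List (Point d)
  directions C {b , u} L t∈L with ∈-∃++ t∈L
  ... | pre , post , _ = Terms.differences ((‖ (b , u) ∷ pre ++ post ‖₁ ℕ.* C) !) u (pre ++ post)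

  directions-nonzero : ∀ C {t} (L : Op d) (t∈L : t ∈ L) → Unique (map proj₂ L) →
                       All (λ v → v ≢ origin d) (directions C L t∈L)
  directions-nonzero C {b , u} L t∈L unique with ∈-∃++ t∈L
  ... | pre , post , refl =
    differences-nonzero ((‖ (b , u) ∷ pre ++ post ‖₁ ℕ.* C) !) {{(‖ (b , u) ∷ pre ++ post ‖₁ ℕ.* C) ℕP.!≢0}} u (pre ++ post)
      (λ u∈ → Unique[xs++v∷ys]⇒v∉xs++ys (map proj₂ pre) (subst Unique (map-++ proj₂ pre _) unique)
                (subst (u ∈_) (map-++ proj₂ pre post) u∈))

  directions-annihilate : ∀ {C} {c : Config d} → (∀ y → ∣ c y ∣ ≤ C) → ∀ {t} (L : Op d) (t∈L : t ∈ L) →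
                          proj₁ t ≢ 0ℤ → Annihilatesℤ L c → ∀ x → diffProd (directions C L t∈L) c x ≡ 0ℤ
  directions-annihilate {C = C} {c} c≤C {b , u} L t∈L b≢0 annihilates with ∈-∃++ t∈L
  ... | pre , post , refl =
    differences-annihilate c≤C b u (pre ++ post) b≢0 (λ x → sym (⟦⟧-↭ (shift (b , u) pre post) c x) ⟨ trans ⟩ annihilates x)

module IntegerHomomorphism {a ℓ} (K : CommutativeRing a ℓ) where
  open import Data.Nat as ℕ using (ℕ; zero; suc)
  import Data.Nat.Properties as ℕP
  open import Data.Integer as ℤ using (ℤ; +_; -[1+_])
  import Data.Integer.Properties as ℤP
  open import Data.Maybe using (Maybe; just; nothing)
  open import Relation.Nullary using (yes; no)
  open import Relation.Binary.PropositionalEquality as ≡ using (_≡_)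
  import Algebra.Properties.Ring as RingProperties
  import Algebra.Properties.AbelianGroup as AbelianGroupProperties
  import Algebra.Properties.CommutativeSemigroup as CommutativeSemigroupProperties
  import Algebra.Solver.Ring as RingSolver
  import Algebra.Solver.Ring.AlmostCommutativeRing as ACR
  import Relation.Binary.Reasoning.Setoid as SetoidReasoning
  open CommutativeRing K
  open OverRing K
  open RingProperties ring using (-‿involutive; -‿distribˡ-*; -0#≈0#)
  open AbelianGroupProperties +-abelianGroup using (⁻¹-∙-comm)
  open CommutativeSemigroupProperties +-commutativeSemigroup using (interchange)
  open SetoidReasoning setoid

  natK-+ : ∀ m n → natK (m ℕ.+ n) ≈ natK m + natK n
  natK-+ zero    n = sym (+-identityˡ _)
  natK-+ (suc m) n = trans (+-congˡ (natK-+ m n)) (sym (+-assoc _ _ _))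

  natK-* : ∀ m n → natK (m ℕ.* n) ≈ natK m * natK n
  natK-* zero    n = sym (zeroˡ _)
  natK-* (suc m) n = begin
    natK (n ℕ.+ m ℕ.* n)             ≈⟨ natK-+ n (m ℕ.* n) ⟩
    natK n + natK (m ℕ.* n)          ≈⟨ +-cong (sym (*-identityˡ _)) (natK-* m n) ⟩
    1# * natK n + natK m * natK n    ≈⟨ sym (distribʳ _ _ _) ⟩
    (1# + natK m) * natK n           ∎

  intK-⊖ : ∀ m n → intK (m ℤ.⊖ n) ≈ natK m - natK n
  intK-⊖ m       zero    = sym (trans (+-congˡ -0#≈0#) (+-identityʳ _))
  intK-⊖ zero    (suc n) = sym (+-identityˡ _)
  intK-⊖ (suc m) (suc n) = begin
    intK (suc m ℤ.⊖ suc n)                  ≡⟨ ≡.cong intK (ℤP.[1+m]⊖[1+n]≡m⊖n m n) ⟩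
    intK (m ℤ.⊖ n)                          ≈⟨ intK-⊖ m n ⟩
    natK m - natK n                       ≈⟨ sym (+-identityˡ _) ⟩
    0# + (natK m - natK n)                ≈⟨ +-congʳ (sym (-‿inverseʳ 1#)) ⟩
    (1# - 1#) + (natK m - natK n)         ≈⟨ interchange 1# (- 1#) (natK m) (- natK n) ⟩
    (1# + natK m) + (- 1# - natK n)       ≈⟨ +-congˡ (⁻¹-∙-comm 1# (natK n)) ⟩
    (1# + natK m) - (1# + natK n)         ∎

  intK-neg : ∀ i → intK (ℤ.- i) ≈ - intK i
  intK-neg (+ zero)  = sym -0#≈0#
  intK-neg (+ suc n) = refl
  intK-neg -[1+ n ]  = sym (-‿involutive _)

  intK-+ : ∀ i j → intK (i ℤ.+ j) ≈ intK i + intK j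
  intK-+ (+ m)    (+ n)    = natK-+ m n
  intK-+ (+ m)    -[1+ n ] = intK-⊖ m (suc n)
  intK-+ -[1+ m ] (+ n)    = trans (intK-⊖ n (suc m)) (+-comm _ _)
  intK-+ -[1+ m ] -[1+ n ] = begin
    - natK (suc (suc (m ℕ.+ n)))            ≡⟨ ≡.cong (λ k → - natK (suc k)) (≡.sym (ℕP.+-suc m n)) ⟩
    - natK (suc m ℕ.+ suc n)                ≈⟨ -‿cong (natK-+ (suc m) (suc n)) ⟩
    - (natK (suc m) + natK (suc n))         ≈⟨ sym (⁻¹-∙-comm _ _) ⟩
    - natK (suc m) + - natK (suc n)         ∎

  intK-*+ : ∀ m j → intK (+ m ℤ.* j) ≈ natK m * intK j
  intK-*+ zero    j = trans (reflexive (≡.cong intK (ℤP.*-zeroˡ j))) (sym (zeroˡ _))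
  intK-*+ (suc m) j = begin
    intK (+ suc m ℤ.* j)                ≡⟨ ≡.cong intK (ℤP.suc-* (+ m) j) ⟩
    intK (j ℤ.+ + m ℤ.* j)              ≈⟨ intK-+ j (+ m ℤ.* j) ⟩
    intK j + intK (+ m ℤ.* j)           ≈⟨ +-cong (sym (*-identityˡ _)) (intK-*+ m j) ⟩
    1# * intK j + natK m * intK j       ≈⟨ sym (distribʳ _ _ _) ⟩
    (1# + natK m) * intK j              ∎

  intK-* : ∀ i j → intK (i ℤ.* j) ≈ intK i * intK j
  intK-* (+ m)    j = intK-*+ m j
  intK-* -[1+ m ] j = begin
    intK (-[1+ m ] ℤ.* j)               ≡⟨ ≡.cong intK (≡.sym (ℤP.neg-distribˡ-* (+ suc m) j)) ⟩
    intK (ℤ.- (+ suc m ℤ.* j))          ≈⟨ intK-neg (+ suc m ℤ.* j) ⟩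
    - intK (+ suc m ℤ.* j)              ≈⟨ -‿cong (intK-*+ (suc m) j) ⟩
    - (natK (suc m) * intK j)           ≈⟨ -‿distribˡ-* _ _ ⟩
    - natK (suc m) * intK j             ∎

  homomorphism : ℤ.+-*-rawRing ACR.-Raw-AlmostCommutative⟶ ACR.fromCommutativeRing K
  homomorphism = record
    { ⟦_⟧ = intK ; +-homo = intK-+ ; *-homo = intK-* ; -‿homo = intK-neg ; 0-homo = refl ; 1-homo = +-identityʳ 1# }

  coefficients≟ : ∀ i j → Maybe (intK i ≈ intK j)
  coefficients≟ i j with i ℤ.≟ j
  ... | yes ≡.refl = just refl
  ... | no _       = nothing

  module Solver = RingSolver ℤ.+-*-rawRing (ACR.fromCommutativeRing K) homomorphism coefficients≟

module LinearAlgebra where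
  open import Data.Nat as ℕ using (ℕ; zero; suc)
  open import Data.Integer as ℤ using (ℤ; +_; -[1+_]; 0ℤ; 1ℤ)
  import Data.Integer.Properties as ℤP
  open import Data.Integer.Tactic.RingSolver using (solve-∀)
  open import Data.Fin using (zero; suc)
  open import Data.Vec as Vec using (Vec; []; _∷_; lookup; head; tail; replicate)
  open import Data.Vec.Properties using (lookup-map)
  open import Data.List using (List; []; _∷_; map)
  open import Data.List.Membership.Propositional using (_∈_; find)
  open import Data.List.Relation.Unary.All as All using (All; []; _∷_)
  open import Data.List.Relation.Unary.All.Properties using (¬All⇒Any¬; map⁺; map⁻)
  open import Data.Product using (Σ; ∃; _×_; _,_; proj₂)
  open import Data.Sum using (_⊎_; inj₁; inj₂)
  open import Algebra.Bundles using (CommutativeRing)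
  open import Function using (_⟨_⟩_)
  open import Relation.Nullary using (¬_; yes; no)
  open import Relation.Binary.PropositionalEquality as ≡ using (_≡_; _≢_)
  import Algebra.Properties.Ring as RingProperties
  import Algebra.Properties.Group as GroupProperties
  import Relation.Binary.Reasoning.Setoid as SetoidReasoning

  private variable n : ℕ

  dotℤ : Vec ℤ n → Vec ℤ n → ℤ
  dotℤ []       []       = 0ℤ
  dotℤ (r ∷ rs) (x ∷ xs) = x ℤ.* r ℤ.+ dotℤ rs xs

  combination : ℤ → ℤ → Vec ℤ n → Vec ℤ n → Vec ℤ n
  combination α β []       []       = []
  combination α β (x ∷ xs) (y ∷ ys) = (α ℤ.* x ℤ.- β ℤ.* y) ∷ combination α β xs ys

  scale : ℤ → Vec ℤ n → Vec ℤ n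
  scale α = Vec.map (α ℤ.*_)

  dotℤ-combination : ∀ α β (r s x : Vec ℤ n) → dotℤ (combination α β r s) x ≡ α ℤ.* dotℤ r x ℤ.- β ℤ.* dotℤ s x
  dotℤ-combination α β []       []       []       = scalar α β
    where
    scalar : ∀ α β → 0ℤ ≡ α ℤ.* 0ℤ ℤ.- β ℤ.* 0ℤ
    scalar = solve-∀
  dotℤ-combination α β (r ∷ rs) (s ∷ ss) (x ∷ xs) =
    ≡.cong (λ z → x ℤ.* (α ℤ.* r ℤ.- β ℤ.* s) ℤ.+ z) (dotℤ-combination α β rs ss xs) ⟨ ≡.trans ⟩
    scalar α β r s x (dotℤ rs xs) (dotℤ ss xs)
    where
    scalar : ∀ α β r s x D E → x ℤ.* (α ℤ.* r ℤ.- β ℤ.* s) ℤ.+ (α ℤ.* D ℤ.- β ℤ.* E) ≡ α ℤ.* (x ℤ.* r ℤ.+ D) ℤ.- β ℤ.* (x ℤ.* s ℤ.+ E)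
    scalar = solve-∀

  dotℤ-scale : ∀ α (r x : Vec ℤ n) → dotℤ r (scale α x) ≡ α ℤ.* dotℤ r x
  dotℤ-scale α []       []       = ≡.sym (ℤP.*-zeroʳ α)
  dotℤ-scale α (r ∷ rs) (x ∷ xs) =
    ≡.cong (λ z → α ℤ.* x ℤ.* r ℤ.+ z) (dotℤ-scale α rs xs) ⟨ ≡.trans ⟩ scalar α r x (dotℤ rs xs)
    where
    scalar : ∀ α r x D → α ℤ.* x ℤ.* r ℤ.+ α ℤ.* D ≡ α ℤ.* (x ℤ.* r ℤ.+ D)
    scalar = solve-∀

  dotℤ-zero : ∀ (r : Vec ℤ n) → dotℤ r (replicate n 0ℤ) ≡ 0ℤ
  dotℤ-zero []       = ≡.refl
  dotℤ-zero (r ∷ rs) = ℤP.+-identityˡ _ ⟨ ≡.trans ⟩ dotℤ-zero rs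

  IntegerSolution : List (Vec ℤ n) → Set
  IntegerSolution {n} rows = Σ (Vec ℤ n) λ x → (∃ λ i → lookup x i ≢ 0ℤ) × All (λ r → dotℤ r x ≡ 0ℤ) rows

  eliminate : ℤ → Vec ℤ n → Vec ℤ (suc n) → Vec ℤ n
  eliminate α pivot r = combination α (head r) (tail r) pivot

  headsZero⇒integerSolution : ∀ {rows : List (Vec ℤ (suc n))} → All (λ r → head r ≡ 0ℤ) rows → IntegerSolution rows
  headsZero⇒integerSolution {n} heads≡0 = 1ℤ ∷ replicate n 0ℤ , (zero , λ ()) , All.map (λ {r} → first-unit r) heads≡0
    where
    first-unit : ∀ r → head r ≡ 0ℤ → dotℤ r (1ℤ ∷ replicate n 0ℤ) ≡ 0ℤ
    first-unit (h ∷ t) h≡0 = ≡.cong₂ ℤ._+_ (ℤP.*-identityˡ h ⟨ ≡.trans ⟩ h≡0) (dotℤ-zero t)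

  eliminate-integerSolution : ∀ {α} {pivot : Vec ℤ n} rows → α ≢ 0ℤ →
                              IntegerSolution (map (eliminate α pivot) rows) → IntegerSolution rows
  eliminate-integerSolution {n} {α} {pivot} rows α≢0 (y , (i , yᵢ≢0) , eliminated⊥y) =
    x , (suc i , xᵢ≢0) , All.map (λ {r} → orthogonal r) (map⁻ eliminated⊥y)
    where
    x : Vec ℤ (suc n)
    x = ℤ.- dotℤ pivot y ∷ scale α y
    xᵢ≢0 : lookup (scale α y) i ≢ 0ℤ
    xᵢ≢0 αyᵢ≡0 with ℤP.i*j≡0⇒i≡0∨j≡0 α (≡.sym (lookup-map i (α ℤ.*_) y) ⟨ ≡.trans ⟩ αyᵢ≡0)
    ... | inj₁ α≡0  = α≢0 α≡0
    ... | inj₂ yᵢ≡0 = yᵢ≢0 yᵢ≡0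
    orthogonal : ∀ r → dotℤ (eliminate α pivot r) y ≡ 0ℤ → dotℤ r x ≡ 0ℤ
    orthogonal (h ∷ t) eliminated⊥y =
      ≡.cong (λ z → (ℤ.- dotℤ pivot y) ℤ.* h ℤ.+ z) (dotℤ-scale α t y) ⟨ ≡.trans ⟩
      scalar α h (dotℤ t y) (dotℤ pivot y) ⟨ ≡.trans ⟩ ≡.sym (dotℤ-combination α h t pivot y) ⟨ ≡.trans ⟩ eliminated⊥y
      where
      scalar : ∀ α h D P → (ℤ.- P) ℤ.* h ℤ.+ α ℤ.* D ≡ α ℤ.* D ℤ.- h ℤ.* P
      scalar = solve-∀

  module _ {a ℓ} (K : CommutativeRing a ℓ) where
    open CommutativeRing K hiding (zero)
    open OverRing K
    open IntegerHomomorphism K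
    open Solver using (solve; con; _:=_; _:*_; _:+_; _:-_; :-_)
    open RingProperties ring using (-‿involutive; -0#≈0#)
    open GroupProperties +-group using (inverseʳ-unique)
    open SetoidReasoning setoid

    dotK : Vec ℤ n → Vec Carrier n → Carrier
    dotK []       []       = 0#
    dotK (r ∷ rs) (x ∷ xs) = x * intK r + dotK rs xs

    dotK-combination : ∀ α β (r s : Vec ℤ n) x → dotK (combination α β r s) x ≈ intK α * dotK r x - intK β * dotK s x
    dotK-combination α β []       []       []       =
      solve 2 (λ A B → con 0ℤ := A :* con 0ℤ :- B :* con 0ℤ) refl (intK α) (intK β)
    dotK-combination α β (r ∷ rs) (s ∷ ss) (x ∷ xs) = begin
      x * intK (α ℤ.* r ℤ.- β ℤ.* s) + dotK (combination α β rs ss) xs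
        ≈⟨ +-cong (*-congˡ (intK-+ (α ℤ.* r) (ℤ.- (β ℤ.* s)) ⟨ trans ⟩ +-cong (intK-* α r) (intK-neg (β ℤ.* s) ⟨ trans ⟩ -‿cong (intK-* β s))))
                  (dotK-combination α β rs ss xs) ⟩
      x * (intK α * intK r - intK β * intK s) + (intK α * dotK rs xs - intK β * dotK ss xs)
        ≈⟨ solve 7 (λ x A R B S D E → x :* (A :* R :- B :* S) :+ (A :* D :- B :* E) := A :* (x :* R :+ D) :- B :* (x :* S :+ E))
                 refl x (intK α) (intK r) (intK β) (intK s) (dotK rs xs) (dotK ss xs) ⟩
      intK α * (x * intK r + dotK rs xs) - intK β * (x * intK s + dotK ss xs)
        ∎

    OnlyTrivialSolution : List (Vec ℤ n) → Set _
    OnlyTrivialSolution {n} rows = ∀ a → All (λ r → dotK r a ≈ 0#) rows → ∀ i → lookup a i ≈ 0#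

    dotK-zero : ∀ (r : Vec ℤ n) x → (∀ i → lookup x i ≈ 0#) → dotK r x ≈ 0#
    dotK-zero []       []       _    = refl
    dotK-zero (r ∷ rs) (x ∷ xs) x≈0 = trans (+-cong (trans (*-congʳ (x≈0 zero)) (zeroˡ _)) (dotK-zero rs xs (λ i → x≈0 (suc i)))) (+-identityʳ 0#)

    module _ (isField : IsField) (charZero : CharZero) where

      intK-nonzero : ∀ {α} → α ≢ 0ℤ → ¬ (intK α ≈ 0#)
      intK-nonzero {+ zero}   α≢0 _     = α≢0 ≡.refl
      intK-nonzero {+ suc n}  _   α≈0 = charZero n α≈0
      intK-nonzero { -[1+ n ]} _  α≈0 = charZero n (trans (sym (-‿involutive _)) (trans (-‿cong α≈0) -0#≈0#))

      cancelʳ : ∀ {x} y → ¬ (x ≈ 0#) → y * x ≈ 0# → y ≈ 0#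
      cancelʳ {x} y x≉0 yx≈0 with proj₂ isField x x≉0
      ... | x⁻¹ , xx⁻¹≈1 = begin
        y                ≈⟨ sym (*-identityʳ y) ⟩
        y * 1#           ≈⟨ *-congˡ (sym xx⁻¹≈1) ⟩
        y * (x * x⁻¹)    ≈⟨ sym (*-assoc y x x⁻¹) ⟩
        (y * x) * x⁻¹    ≈⟨ *-congʳ yx≈0 ⟩
        0# * x⁻¹         ≈⟨ zeroˡ x⁻¹ ⟩
        0#               ∎

      eliminate-onlyTrivialSolution : ∀ {α} {pivot : Vec ℤ n} {rows} → α ≢ 0ℤ → α ∷ pivot ∈ rows →
                                      OnlyTrivialSolution (map (eliminate α pivot) rows) → OnlyTrivialSolution rows
      eliminate-onlyTrivialSolution {n} {α} {pivot} {rows} α≢0 pivot∈rows trivial (a₀ ∷ as) rows⊥a = λ where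
          zero    → a₀≈0
          (suc i) → as≈0 i
        where
        pivot⊥a : a₀ * intK α + dotK pivot as ≈ 0#
        pivot⊥a = All.lookup rows⊥a pivot∈rows

        eliminated⊥as : ∀ r → dotK r (a₀ ∷ as) ≈ 0# → dotK (eliminate α pivot r) as ≈ 0#
        eliminated⊥as (h ∷ t) r⊥a = begin
          dotK (combination α h t pivot) as                    ≈⟨ dotK-combination α h t pivot as ⟩
          intK α * dotK t as - intK h * dotK pivot as          ≈⟨ +-cong (*-congˡ (inverseʳ-unique _ _ r⊥a)) (-‿cong (*-congˡ (inverseʳ-unique _ _ pivot⊥a))) ⟩
          intK α * - (a₀ * intK h) - intK h * - (a₀ * intK α)  ≈⟨ solve 3 (λ A H a → A :* :- (a :* H) :- H :* :- (a :* A) := con 0ℤ) refl (intK α) (intK h) a₀ ⟩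
          0#                                                   ∎

        as≈0 : ∀ i → lookup as i ≈ 0#
        as≈0 = trivial as (map⁺ (All.map (λ {r} → eliminated⊥as r) rows⊥a))

        a₀≈0 : a₀ ≈ 0#
        a₀≈0 = cancelʳ a₀ (intK-nonzero α≢0) (begin
          a₀ * intK α                    ≈⟨ sym (+-identityʳ _) ⟩
          a₀ * intK α + 0#               ≈⟨ +-congˡ (sym (dotK-zero pivot as as≈0)) ⟩
          a₀ * intK α + dotK pivot as    ≈⟨ pivot⊥a ⟩
          0#                             ∎)

      integerSolution⊎onlyTrivialSolution : ∀ n (rows : List (Vec ℤ n)) → IntegerSolution rows ⊎ OnlyTrivialSolution rows
      integerSolution⊎onlyTrivialSolution zero    rows = inj₂ (λ a _ ())
      integerSolution⊎onlyTrivialSolution (suc n) rows with All.all? (λ r → head r ℤ.≟ 0ℤ) rows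
      ... | yes heads≡0 = inj₁ (headsZero⇒integerSolution heads≡0)
      ... | no ¬heads≡0 with find (¬All⇒Any¬ (λ r → head r ℤ.≟ 0ℤ) rows ¬heads≡0)
      ...   | α ∷ pivot , pivot∈rows , α≢0 with integerSolution⊎onlyTrivialSolution n (map (eliminate α pivot) rows)
      ...     | inj₁ solution = inj₁ (eliminate-integerSolution rows α≢0 solution)
      ...     | inj₂ trivial  = inj₂ (eliminate-onlyTrivialSolution α≢0 pivot∈rows trivial)

module Enumeration where
  open import Data.Nat using (ℕ; zero; suc)
  open import Data.Fin using (zero; suc)
  open import Data.Vec using (Vec; []; _∷_; lookup)
  open import Data.List using (List; []; _∷_; _++_; [_]; map; concatMap)
  open import Data.List.Membership.Propositional using (_∈_)
  open import Data.List.Membership.Propositional.Properties using (∈-map⁺; ∈-++⁺ˡ; ∈-++⁺ʳ)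
  open import Data.List.Relation.Unary.All using (All; []; _∷_)
  open import Data.List.Relation.Unary.Any using (here; there)
  open import Data.Product using (∃; _×_; _,_)
  open import Relation.Nullary using (¬_; Dec; yes; no; contradiction)
  open import Relation.Nullary.Decidable using (¬¬-excluded-middle)
  open import Relation.Binary.PropositionalEquality using (refl)

  private variable A : Set

  vectorsOver : List A → ∀ n → List (Vec A n)
  vectorsOver xs zero    = [ [] ]
  vectorsOver xs (suc n) = concatMap (λ x → map (x ∷_) (vectorsOver xs n)) xs

  ∈-vectorsOver : ∀ (xs : List A) {n} (v : Vec A n) → (∀ i → lookup v i ∈ xs) → v ∈ vectorsOver xs n
  ∈-vectorsOver xs []      _      = here refl
  ∈-vectorsOver xs (x ∷ v) v⊆xs = go xs (v⊆xs zero)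
    where
    rest = ∈-vectorsOver xs v (λ i → v⊆xs (suc i))
    go : ∀ ys → x ∈ ys → x ∷ v ∈ concatMap (λ y → map (y ∷_) (vectorsOver xs _)) ys
    go (y ∷ ys) (here refl) = ∈-++⁺ˡ (∈-map⁺ (x ∷_) rest)
    go (y ∷ ys) (there x∈ys) = ∈-++⁺ʳ (map (y ∷_) (vectorsOver xs _)) (go ys x∈ys)

  sublists : List A → List (List A)
  sublists []       = [ [] ]
  sublists (x ∷ xs) = map (x ∷_) (sublists xs) ++ sublists xs

  SublistOfSatisfying : ∀ {ℓ} → (A → Set ℓ) → List A → Set ℓ
  SublistOfSatisfying Q xs = ∃ λ P → P ∈ sublists xs × All Q P × (∀ {x} → x ∈ xs → Q x → x ∈ P)

  ¬¬-sublistOfSatisfying : ∀ {ℓ} (Q : A → Set ℓ) xs → ¬ ¬ SublistOfSatisfying Q xs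
  ¬¬-sublistOfSatisfying Q []       ¬P = ¬P ([] , here refl , [] , λ ())
  ¬¬-sublistOfSatisfying Q (x ∷ xs) ¬P =
    ¬¬-sublistOfSatisfying Q xs λ P-xs → ¬¬-excluded-middle λ Q?x → ¬P (extend P-xs Q?x)
    where
    extend : SublistOfSatisfying Q xs → Dec (Q x) → SublistOfSatisfying Q (x ∷ xs)
    extend (P , P∈ , all-Q , closed) (yes qx) = x ∷ P , ∈-++⁺ˡ (∈-map⁺ (x ∷_) P∈) , qx ∷ all-Q , closed′
      where
      closed′ : ∀ {y} → y ∈ x ∷ xs → Q y → y ∈ x ∷ P
      closed′ (here refl)  _  = here refl
      closed′ (there y∈xs) qy = there (closed y∈xs qy)
    extend (P , P∈ , all-Q , closed) (no ¬qx) = P , ∈-++⁺ʳ (map (x ∷_) (sublists xs)) P∈ , all-Q , closed′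
      where
      closed′ : ∀ {y} → y ∈ x ∷ xs → Q y → y ∈ P
      closed′ (here refl)  qx = contradiction qx ¬qx
      closed′ (there y∈xs) qy = closed y∈xs qy

module Reduction where
  open Points
  open Operators
  open IntegerAnnihilators
  open LinearAlgebra
  open Differences
  open Enumeration
  open import Data.Nat as ℕ using (ℕ; zero; suc; _≤_)
  import Data.Nat.Properties as ℕP
  open import Data.Nat.ListAction using (sum)
  open import Data.Integer as ℤ using (ℤ; 0ℤ; ∣_∣)
  open import Data.Fin using (zero; suc)
  open import Data.Vec as Vec using (Vec; []; _∷_; lookup; fromList)
  open import Data.Vec.Properties using (lookup-map)
  open import Data.List using (List; []; _∷_; length; map; concat)
  open import Data.List.Membership.Propositional using (_∈_)
  open import Data.List.Membership.Propositional.Properties using (∈-map⁺)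
  open import Data.List.Relation.Unary.All as All using (All; []; _∷_)
  open import Data.List.Relation.Unary.All.Properties using (concat⁺; map⁺)
  open import Data.List.Relation.Unary.Any using (here; there)
  open import Data.List.Relation.Unary.Unique.Propositional using (Unique)
  open import Data.Product using (Σ; _×_; _,_; proj₂)
  open import Data.Sum using (inj₁; inj₂)
  open import Algebra.Bundles using (CommutativeRing)
  open import Relation.Nullary using (¬_; contradiction)
  open import Relation.Nullary.Negation using (¬¬-map)
  open import Relation.Nullary.Decidable using (decidable-stable)
  open import Relation.Binary.PropositionalEquality as ≡ using (_≡_; _≢_; refl; cong; subst)
  open import Function using (_⟨_⟩_)

  private variable d : ℕ

  ∈⇒∣∣≤sum∣∣ : ∀ {v} {vs : List ℤ} → v ∈ vs → ∣ v ∣ ≤ sum (map ∣_∣ vs)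
  ∈⇒∣∣≤sum∣∣ {vs = w ∷ vs} (here refl)  = ℕP.m≤m+n ∣ w ∣ _
  ∈⇒∣∣≤sum∣∣ {vs = w ∷ vs} (there v∈vs) = ℕP.≤-trans (∈⇒∣∣≤sum∣∣ v∈vs) (ℕP.m≤n+m _ ∣ w ∣)

  window : Config d → (S : List (Point d)) → Point d → Vec ℤ (length S)
  window c S x = Vec.map (λ u → c (x ⊖ u)) (fromList S)

  withSupport : (S : List (Point d)) → Vec ℤ (length S) → Op d
  withSupport []      []      = []
  withSupport (u ∷ S) (g ∷ gs) = (g , u) ∷ withSupport S gs

  ⟦withSupport⟧ : ∀ (S : List (Point d)) g c x → ⟦ withSupport S g ⟧ c x ≡ dotℤ (window c S x) g
  ⟦withSupport⟧ []      []       c x = refl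
  ⟦withSupport⟧ (u ∷ S) (g ∷ gs) c x = cong (λ z → g ℤ.* c (x ⊖ u) ℤ.+ z) (⟦withSupport⟧ S gs c x)

  exponents-withSupport : ∀ (S : List (Point d)) g → map proj₂ (withSupport S g) ≡ S
  exponents-withSupport []      []       = refl
  exponents-withSupport (u ∷ S) (g ∷ gs) = cong (u ∷_) (exponents-withSupport S gs)

  lookup∈withSupport : ∀ (S : List (Point d)) g i → (lookup g i , lookup (fromList S) i) ∈ withSupport S g
  lookup∈withSupport (u ∷ S) (g ∷ gs) zero    = here refl
  lookup∈withSupport (u ∷ S) (g ∷ gs) (suc i) = there (lookup∈withSupport S gs i)

  module FromLaurentAnnihilator {a ℓ} (K : CommutativeRing a ℓ) (isField : OverRing.IsField K) (charZero : OverRing.CharZero K)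
                                 {d} (c : Config d) (f : OverRing.Laurent K d) where
    open CommutativeRing K using (Carrier; _≈_; 0#; _+_; _*_; sym; trans; reflexive)
    open OverRing K using (act; sumK; intK; coeff; support; unique; finite; NonZero; Annihilates)

    s : ℕ
    s = length (support f)

    coefficients : Vec Carrier s
    coefficients = Vec.map (coeff f) (fromList (support f))

    patternAt : Point d → Vec ℤ s
    patternAt = window c (support f)

    Orthogonal : Vec ℤ s → Set ℓ
    Orthogonal π = dotK K π coefficients ≈ 0#

    act≡dotK : ∀ x → act f c x ≡ dotK K (patternAt x) coefficients
    act≡dotK x = go (support f)
      where
      go : ∀ S → sumK (map (λ u → coeff f u * intK (c (x ⊖ u))) S) ≡ dotK K (window c S x) (Vec.map (coeff f) (fromList S))
      go []      = refl
      go (u ∷ S) = cong (coeff f u * intK (c (x ⊖ u)) +_) (go S)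

    patternAt∈vectorsOver : ∀ {values} → (∀ y → c y ∈ values) → ∀ x → patternAt x ∈ vectorsOver values s
    patternAt∈vectorsOver {values} c∈values x =
      ∈-vectorsOver values (patternAt x) (λ i → subst (_∈ values) (≡.sym (lookup-map i _ (fromList (support f)))) (c∈values _))

    patternAt⊥coefficients : Annihilates f c → ∀ x → Orthogonal (patternAt x)
    patternAt⊥coefficients f-annihilates x = trans (reflexive (≡.sym (act≡dotK x))) (f-annihilates x)

    coefficients≉0 : NonZero f → ¬ (∀ i → lookup coefficients i ≈ 0#)
    coefficients≉0 (u , fᵤ≉0) coefficients≈0 = fᵤ≉0 (go (support f) (finite f u fᵤ≉0) coefficients≈0)
      where
      go : ∀ S → u ∈ S → (∀ i → lookup (Vec.map (coeff f) (fromList S)) i ≈ 0#) → coeff f u ≈ 0#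
      go (u ∷ S) (here refl)  S≈0 = S≈0 zero
      go (w ∷ S) (there u∈S) S≈0 = go S u∈S (λ i → S≈0 (suc i))

    candidateDirections : ℕ → List (Vec ℤ s) → List (Point d)
    candidateDirections C P with integerSolution⊎onlyTrivialSolution K isField charZero s P
    ... | inj₁ (g , (i , _) , _) = directions C (withSupport (support f) g) (lookup∈withSupport (support f) g i)
    ... | inj₂ _                 = []

    candidateDirections-nonzero : ∀ C P → All (λ v → v ≢ origin d) (candidateDirections C P)
    candidateDirections-nonzero C P with integerSolution⊎onlyTrivialSolution K isField charZero s P
    ... | inj₁ (g , (i , _) , _) =
      directions-nonzero C (withSupport (support f) g) (lookup∈withSupport (support f) g i)
        (subst Unique (≡.sym (exponents-withSupport (support f) g)) (unique f))
    ... | inj₂ _ = []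

    candidateDirections-annihilate : ∀ {C} → (∀ y → ∣ c y ∣ ≤ C) → NonZero f →
      ∀ P → All Orthogonal P → (∀ x → patternAt x ∈ P) →
      ∀ x → diffProd (candidateDirections C P) c x ≡ 0ℤ
    candidateDirections-annihilate c≤C f≢0 P P⊥coefficients windows∈P with integerSolution⊎onlyTrivialSolution K isField charZero s P
    ... | inj₁ (g , (i , gᵢ≢0) , P⊥g) =
      directions-annihilate c≤C (withSupport (support f) g) (lookup∈withSupport (support f) g i) gᵢ≢0
        (λ x → ⟦withSupport⟧ (support f) g c x ⟨ ≡.trans ⟩ All.lookup P⊥g (windows∈P x))
    ... | inj₂ only-trivial = contradiction (only-trivial coefficients P⊥coefficients) (coefficients≉0 f≢0)

    directionsFor : List ℤ → List (Point d)
    directionsFor values = concat (map (candidateDirections (sum (map ∣_∣ values))) (sublists (vectorsOver values s)))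

    directionsFor-nonzero : ∀ values → All (λ v → v ≢ origin d) (directionsFor values)
    directionsFor-nonzero values =
      concat⁺ (map⁺ (All.universal (candidateDirections-nonzero (sum (map ∣_∣ values))) (sublists (vectorsOver values s))))

    directionsFor-annihilate : NonZero f → Annihilates f c → ∀ {values} → (∀ y → c y ∈ values) →
                               ∀ x → diffProd (directionsFor values) c x ≡ 0ℤ
    directionsFor-annihilate f≢0 f-annihilates {values} c∈values x =
      decidable-stable (_ ℤ.≟ 0ℤ) (¬¬-map kills (¬¬-sublistOfSatisfying Orthogonal patterns))
      where
      patterns = vectorsOver values s
      kills : SublistOfSatisfying Orthogonal patterns → diffProd (directionsFor values) c x ≡ 0ℤ
      kills (P , P∈sublists , P⊥coefficients , closed) =
        diffProd-concat (∈-map⁺ (candidateDirections _) P∈sublists)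
          (candidateDirections-annihilate (λ y → ∈⇒∣∣≤sum∣∣ (c∈values y)) f≢0 P P⊥coefficients
            (λ y → closed (patternAt∈vectorsOver c∈values y) (patternAt⊥coefficients f-annihilates y)))
          x

open import Data.Nat using (ℕ)
open import Data.Integer using (ℤ; 0ℤ)
open import Data.List using (List)
open import Data.List.Relation.Unary.All using (All)
open import Data.Product using (Σ; _×_; _,_)
open import Relation.Binary.PropositionalEquality using (_≡_; _≢_)
open Reduction using (module FromLaurentAnnihilator)

mainTheorem5 : ∀ {a ℓ} (K : CommutativeRing a ℓ)
    → OverRing.IsField K → OverRing.CharZero K
    → (d : ℕ) (c : Config d)
    → Finitary c
    → OverRing.HasNontrivialAnnihilator K c
    → Σ (List (Point d)) λ vs → All (λ v → v ≢ origin d) vs × (∀ x → diffProd vs c x ≡ 0ℤ)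
mainTheorem5 K isField charZero d c (values , c∈values) (f , f≢0 , f-annihilates) =
  directionsFor values , directionsFor-nonzero values , directionsFor-annihilate f≢0 f-annihilates c∈values
  where open FromLaurentAnnihilator K isField charZero c f
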